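{- Let $n \geq 2$ be an integer and let $k, i$ be integers with $0 \leq k \leq \lfloor n/2 \rfloor - 1$ and $0 \leq i < \lfloor n/2 \rfloor$. Then $$\frac{\alpha_{n,k,i}}{\alpha_{n,k,0}} \geq \frac{\alpha_{n,k+1,i}}{\alpha_{n,k+1,0}}.$$
   Context: For integers $n \geq 0$, $0 \leq k \leq \lfloor n/2 \rfloor$ and $0 \leq j \leq \lfloor n/2 \rfloor$, let $\chi_{n,k}(j)$ denote the value of the irreducible character of $\mathfrak{S}_n$ indexed by the partition $(n-k,k)$ at a permutation of cycle type $2^j1^{n-2j}$. For $0 \leq i \leq \lfloor n/2\rfloor$ define $\alpha_{n,k,i}$ by $2^i\alpha_{n,k,i} = \sum_{j=0}^{i}\binom{i}{j}\chi_{n,k}(j)$. In particular $\alpha_{n,k,0} = \chi_{n,k}(\mathrm{id}) = \binom{n}{k}-\binom{n}{k-1} > 0$. -}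

module Defs where

open import Data.Nat as ℕ using (ℕ; zero; suc; _∸_; ⌊_/2⌋)
open import Data.Nat.Combinatorics using (_C_)
open import Data.Integer as ℤ using (ℤ; +_)
open import Data.Rational as ℚ using (ℚ; 0ℚ; 1ℚ; ≢-nonZero)
open import Data.Rational.Properties using (_≟_)
open import Relation.Nullary using (yes; no)

sumUpTo : ℕ → (ℕ → ℕ) → ℕ
sumUpTo zero    f = f 0
sumUpTo (suc b) f = sumUpTo b f ℕ.+ f (suc b)

sumUpToℤ : ℕ → (ℕ → ℤ) → ℤ
sumUpToℤ zero    f = f 0
sumUpToℤ (suc b) f = sumUpToℤ b f ℤ.+ f (suc b)

-- Number of k-element subsets of {1..n} fixed (setwise) by a permutation of
-- cycle type 2^j 1^(n-2j): choose m of the j transpositions and k-2m of the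
-- n-2j fixed points.  This is the value at such a permutation of the
-- permutation character π_{n,k} of S_n on k-subsets (for 2j ≤ n).
fixedSubsets : ℕ → ℕ → ℕ → ℕ
fixedSubsets n k j = sumUpTo ⌊ k /2⌋ (λ m → (j C m) ℕ.* ((n ∸ 2 ℕ.* j) C (k ∸ 2 ℕ.* m)))

-- χ_{n,k}(j): the irreducible character of S_n indexed by (n-k,k) at a
-- permutation of cycle type 2^j 1^(n-2j), via Young's rule
-- χ^{(n-k,k)} = π_{n,k} - π_{n,k-1}  (with π_{n,-1} = 0).
χ : ℕ → ℕ → ℕ → ℤ
χ n zero    j = + fixedSubsets n 0 j
χ n (suc k) j = + fixedSubsets n (suc k) j ℤ.- + fixedSubsets n k j

halfPow : ℕ → ℚ
halfPow zero    = 1ℚ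
halfPow (suc i) = (+ 1 ℚ./ 2) ℚ.* halfPow i

α : ℕ → ℕ → ℕ → ℚ
α n k i = ℚ._*_ (ℚ._/_ (sumUpToℤ i (λ j → + (i C j) ℤ.* χ n k j)) 1) (halfPow i)

-- total division on ℚ (x / 0 := 0); only ever applied to nonzero
-- denominators in the statement.
_÷?_ : ℚ → ℚ → ℚ
x ÷? y with y ≟ 0ℚ
... | yes _  = 0ℚ
... | no y≢0 = ℚ._÷_ x y {{≢-nonZero y≢0}}

{-# OPTIONS --safe #-}
-- Read a sequence f : ℕ → ℤ as the power series Σ f k xᵏ, and write ⟨p⟩ for multiplication by the
-- polynomial p.  Counting fixed k-subsets gives χ_{n,·}(j) = (1 - x)(1 + x²)ʲ(1 + x)ⁿ⁻²ʲ, so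
-- Pascal's rule in i turns 2ⁱ α_{n,·,i} = Σ_j C(i,j) χ_{n,·}(j) into 2ⁱ (1 + x + x²)ⁱ B_{n-2i}, where
-- B_m = (1 - x)(1 + x)ᵐ lists the ballot numbers and α_{n,·,0} = B_n.
-- For odd n = 2c + 1 induct on i: a = (1 + x + x²)ⁱ B_{n-2i} stays nonnegative, antipalindromic of
-- degree 2c + 2, and a / B_{2c+1} stays nonincreasing on [0, c + 1].  Passing from (a, B_m) to
-- ((1 + x + x²) a, (1 + x)² B_m) is an explicit identity whose terms are nonnegative by the induction
-- hypothesis and two inequalities between ballot numbers of consecutive odd levels; these follow from the
-- closed form of B_m(k + 1) / B_m(k).  Even n = 2c + 2 then follows from n = 2c + 1 by the mediant
-- inequality, as both sequences are multiplied by 1 + x.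
module Submission where

open import Defs
open import Data.Nat using (ℕ; suc; _≤_; _<_; ⌊_/2⌋)
open import Data.Rational using (_≥_)

open import Data.Nat as ℕ using (zero; z≤n; s≤s; _∸_)
import Data.Nat.Properties as ℕ
open import Data.Nat.Combinatorics using (_C_; nC1≡n; nCk+nC[k+1]≡[n+1]C[k+1])
open import Data.Nat.GeneralisedArithmetic using (fold)
import Data.Nat.Tactic.RingSolver as ℕ-Solver
open import Data.List using (_∷_; [])
open import Data.Product using (_,_)
open import Data.Sum using (_⊎_; inj₁; inj₂)
open import Data.Integer as ℤ using (ℤ; +_; -[1+_]; 0ℤ; _+_; _-_; _*_)
import Data.Integer.Properties as ℤ
open import Data.Integer.Tactic.RingSolver using (solve-∀)
open import Data.Rational as ℚ using (ℚ; mkℚ; 0ℚ; 1ℚ)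
import Data.Rational.Properties as ℚ
open import Data.Rational.Solver using (module +-*-Solver)
open import Data.Nat.Coprimality using (Coprime; 1-coprimeTo) renaming (sym to coprime-sym)
open import Data.Empty using (⊥-elim)
open import Relation.Nullary using (yes; no)
open import Relation.Binary.PropositionalEquality

binom : ℕ → ℕ → ℕ
binom n       zero    = 1
binom zero    (suc k) = 0
binom (suc n) (suc k) = binom n k ℕ.+ binom n (suc k)

C≡binom : ∀ n k → n C k ≡ binom n k
C≡binom n       zero    = refl
C≡binom zero    (suc k) = refl
C≡binom (suc n) (suc k) = begin
  suc n C suc k              ≡⟨ nCk+nC[k+1]≡[n+1]C[k+1] n k ⟨
  n C k ℕ.+ n C suc k        ≡⟨ cong₂ ℕ._+_ (C≡binom n k) (C≡binom n (suc k)) ⟩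
  binom n k ℕ.+ binom n (suc k) ∎
  where open ≡-Reasoning

binom-above : ∀ n k → n < k → binom n k ≡ 0
binom-above zero    (suc k) _         = refl
binom-above (suc n) (suc k) (s≤s n<k) =
  cong₂ ℕ._+_ (binom-above n k n<k) (binom-above n (suc k) (ℕ.m≤n⇒m≤1+n n<k))

binom-absorb : ∀ n k → binom n (suc k) ℕ.* suc k ℕ.+ binom n k ℕ.* k ≡ binom n k ℕ.* n
binom-absorb zero    zero    = refl
binom-absorb zero    (suc k) = refl
binom-absorb (suc n) zero    = begin
  binom (suc n) 1 ℕ.* 1 ℕ.+ 0 ≡⟨ ℕ.+-identityʳ _ ⟩
  binom (suc n) 1 ℕ.* 1       ≡⟨ ℕ.*-identityʳ _ ⟩
  binom (suc n) 1             ≡⟨ C≡binom (suc n) 1 ⟨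
  suc n C 1                   ≡⟨ nC1≡n (suc n) ⟩
  suc n                       ≡⟨ ℕ.*-identityˡ (suc n) ⟨
  1 ℕ.* suc n                 ∎
  where open ≡-Reasoning
binom-absorb (suc n) (suc k) =
  pascal-step (binom n (suc (suc k))) (binom n (suc k)) (binom n k)
              (binom-absorb n (suc k)) (binom-absorb n k)
  where
  open ≡-Reasoning
  pascal-step : ∀ P Q R → P ℕ.* suc (suc k) ℕ.+ Q ℕ.* suc k ≡ Q ℕ.* n →
                Q ℕ.* suc k ℕ.+ R ℕ.* k ≡ R ℕ.* n →
                (Q ℕ.+ P) ℕ.* suc (suc k) ℕ.+ (R ℕ.+ Q) ℕ.* suc k ≡ (R ℕ.+ Q) ℕ.* suc n
  pascal-step P Q R eq₁ eq₂ = begin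
    (Q ℕ.+ P) ℕ.* suc (suc k) ℕ.+ (R ℕ.+ Q) ℕ.* suc k
      ≡⟨ ℕ-Solver.solve (P ∷ Q ∷ R ∷ k ∷ []) ⟩
    (P ℕ.* suc (suc k) ℕ.+ Q ℕ.* suc k) ℕ.+ (Q ℕ.* suc k ℕ.+ R ℕ.* k) ℕ.+ (Q ℕ.+ R)
      ≡⟨ cong₂ (λ x y → x ℕ.+ y ℕ.+ (Q ℕ.+ R)) eq₁ eq₂ ⟩
    Q ℕ.* n ℕ.+ R ℕ.* n ℕ.+ (Q ℕ.+ R)
      ≡⟨ ℕ-Solver.solve (Q ∷ R ∷ n ∷ []) ⟩
    (R ℕ.+ Q) ℕ.* suc n ∎

+-medial : ∀ a b c d → a + b + (c + d) ≡ a + c + (b + d)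
+-medial = solve-∀

sumUpToℤ-cong : ∀ b {f g : ℕ → ℤ} → (∀ j → j ≤ b → f j ≡ g j) → sumUpToℤ b f ≡ sumUpToℤ b g
sumUpToℤ-cong zero    f≡g = f≡g 0 z≤n
sumUpToℤ-cong (suc b) f≡g =
  cong₂ _+_ (sumUpToℤ-cong b (λ j j≤b → f≡g j (ℕ.m≤n⇒m≤1+n j≤b))) (f≡g (suc b) ℕ.≤-refl)

sumUpToℤ-peel : ∀ b f → sumUpToℤ (suc b) f ≡ f 0 + sumUpToℤ b (λ j → f (suc j))
sumUpToℤ-peel zero    f = refl
sumUpToℤ-peel (suc b) f = begin
  sumUpToℤ (suc b) f + f (suc (suc b))                         ≡⟨ cong (_+ f (suc (suc b))) (sumUpToℤ-peel b f) ⟩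
  f 0 + sumUpToℤ b (λ j → f (suc j)) + f (suc (suc b))         ≡⟨ ℤ.+-assoc (f 0) _ _ ⟩
  f 0 + (sumUpToℤ b (λ j → f (suc j)) + f (suc (suc b)))       ∎
  where open ≡-Reasoning

sumUpToℤ-+ : ∀ b f g → sumUpToℤ b (λ j → f j + g j) ≡ sumUpToℤ b f + sumUpToℤ b g
sumUpToℤ-+ zero    f g = refl
sumUpToℤ-+ (suc b) f g = begin
  sumUpToℤ b (λ j → f j + g j) + (f (suc b) + g (suc b))  ≡⟨ cong (_+ (f (suc b) + g (suc b))) (sumUpToℤ-+ b f g) ⟩
  sumUpToℤ b f + sumUpToℤ b g + (f (suc b) + g (suc b))   ≡⟨ +-medial (sumUpToℤ b f) (sumUpToℤ b g) _ _ ⟩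
  sumUpToℤ b f + f (suc b) + (sumUpToℤ b g + g (suc b))   ∎
  where open ≡-Reasoning

sumUpToℤ-* : ∀ b c f → sumUpToℤ b (λ j → c * f j) ≡ c * sumUpToℤ b f
sumUpToℤ-* zero    c f = refl
sumUpToℤ-* (suc b) c f =
  trans (cong (_+ c * f (suc b)) (sumUpToℤ-* b c f)) (sym (ℤ.*-distribˡ-+ c _ _))

sumUpToℤ-zero : ∀ b → sumUpToℤ b (λ _ → 0ℤ) ≡ 0ℤ
sumUpToℤ-zero zero    = refl
sumUpToℤ-zero (suc b) = cong (_+ 0ℤ) (sumUpToℤ-zero b)

+-sumUpTo : ∀ b f → + sumUpTo b f ≡ sumUpToℤ b (λ j → + f j)
+-sumUpTo zero    f = refl
+-sumUpTo (suc b) f = trans (ℤ.pos-+ (sumUpTo b f) (f (suc b))) (cong (_+ + f (suc b)) (+-sumUpTo b f))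

Seq : Set
Seq = ℕ → ℤ

infixl 6 _⊕_ _⊖_
infixr 7 _·_

_⊕_ _⊖_ : Seq → Seq → Seq
(f ⊕ g) k = f k + g k
(f ⊖ g) k = f k - g k

_·_ : ℤ → Seq → Seq
(c · f) k = c * f k

⟨x⟩ : Seq → Seq
⟨x⟩ f zero    = 0ℤ
⟨x⟩ f (suc k) = f k

⟨1+x⟩ ⟨1-x⟩ ⟨1+x²⟩ ⟨1+x+x²⟩ : Seq → Seq
⟨1+x⟩ f    = f ⊕ ⟨x⟩ f
⟨1-x⟩ f    = f ⊖ ⟨x⟩ f
⟨1+x²⟩ f   = f ⊕ ⟨x⟩ (⟨x⟩ f)
⟨1+x+x²⟩ f = f ⊕ ⟨x⟩ f ⊕ ⟨x⟩ (⟨x⟩ f)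

⟨x⟩-cong : ∀ {f g} → f ≗ g → ⟨x⟩ f ≗ ⟨x⟩ g
⟨x⟩-cong f≗g zero    = refl
⟨x⟩-cong f≗g (suc k) = f≗g k

⟨x⟩-⊕ : ∀ f g → ⟨x⟩ (f ⊕ g) ≗ ⟨x⟩ f ⊕ ⟨x⟩ g
⟨x⟩-⊕ f g zero    = refl
⟨x⟩-⊕ f g (suc k) = refl

⟨x⟩-· : ∀ c f → ⟨x⟩ (c · f) ≗ c · ⟨x⟩ f
⟨x⟩-· c f zero    = sym (ℤ.*-zeroʳ c)
⟨x⟩-· c f (suc k) = refl

⟨1+x⟩-cong : ∀ {f g} → f ≗ g → ⟨1+x⟩ f ≗ ⟨1+x⟩ g
⟨1+x⟩-cong f≗g k = cong₂ _+_ (f≗g k) (⟨x⟩-cong f≗g k)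

⟨1-x⟩-cong : ∀ {f g} → f ≗ g → ⟨1-x⟩ f ≗ ⟨1-x⟩ g
⟨1-x⟩-cong f≗g k = cong₂ _-_ (f≗g k) (⟨x⟩-cong f≗g k)

⟨1+x²⟩-cong : ∀ {f g} → f ≗ g → ⟨1+x²⟩ f ≗ ⟨1+x²⟩ g
⟨1+x²⟩-cong f≗g k = cong₂ _+_ (f≗g k) (⟨x⟩-cong (⟨x⟩-cong f≗g) k)

⟨1+x+x²⟩-cong : ∀ {f g} → f ≗ g → ⟨1+x+x²⟩ f ≗ ⟨1+x+x²⟩ g
⟨1+x+x²⟩-cong f≗g k = cong₂ _+_ (⟨1+x⟩-cong f≗g k) (⟨x⟩-cong (⟨x⟩-cong f≗g) k)

⟨x⟩-⟨1+x⟩ : ∀ f → ⟨x⟩ (⟨1+x⟩ f) ≗ ⟨1+x⟩ (⟨x⟩ f)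
⟨x⟩-⟨1+x⟩ f = ⟨x⟩-⊕ f (⟨x⟩ f)

⟨1+x+x²⟩-· : ∀ c f → ⟨1+x+x²⟩ (c · f) ≗ c · ⟨1+x+x²⟩ f
⟨1+x+x²⟩-· c f k =
  trans (cong₂ (λ s t → c * f k + s + t) (⟨x⟩-· c f k) (trans (⟨x⟩-cong (⟨x⟩-· c f) k) (⟨x⟩-· c (⟨x⟩ f) k)))
        (sym (distrib₃ c (f k) (⟨x⟩ f k) (⟨x⟩ (⟨x⟩ f) k)))
  where
  distrib₃ : ∀ c a b d → c * (a + b + d) ≡ c * a + c * b + c * d
  distrib₃ = solve-∀

⟨1+x+x²⟩-⟨1+x⟩ : ∀ f → ⟨1+x+x²⟩ (⟨1+x⟩ f) ≗ ⟨1+x⟩ (⟨1+x+x²⟩ f)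
⟨1+x+x²⟩-⟨1+x⟩ f k = begin
  ⟨1+x⟩ f k + ⟨x⟩ (⟨1+x⟩ f) k + ⟨x⟩ (⟨x⟩ (⟨1+x⟩ f)) k
    ≡⟨ cong₂ (λ s t → ⟨1+x⟩ f k + s + t) (⟨x⟩-⟨1+x⟩ f k)
             (trans (⟨x⟩-cong (⟨x⟩-⟨1+x⟩ f) k) (⟨x⟩-⟨1+x⟩ (⟨x⟩ f) k)) ⟩
  (f₀ + f₁) + (f₁ + f₂) + (f₂ + f₃)
    ≡⟨ regroup f₀ f₁ f₂ f₃ ⟩
  (f₀ + f₁ + f₂) + (f₁ + f₂ + f₃)
    ≡⟨ cong (_+_ (f₀ + f₁ + f₂)) (trans (⟨x⟩-⊕ (⟨1+x⟩ f) (⟨x⟩ (⟨x⟩ f)) k)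
                                        (cong (_+ f₃) (⟨x⟩-⟨1+x⟩ f k))) ⟨
  ⟨1+x⟩ (⟨1+x+x²⟩ f) k ∎
  where
  open ≡-Reasoning
  f₀ = f k
  f₁ = ⟨x⟩ f k
  f₂ = ⟨x⟩ (⟨x⟩ f) k
  f₃ = ⟨x⟩ (⟨x⟩ (⟨x⟩ f)) k
  regroup : ∀ a b c d → (a + b) + (b + c) + (c + d) ≡ (a + b + c) + (b + c + d)
  regroup = solve-∀

⟨1+x+x²⟩≗⟨1+x⟩²⊖⟨x⟩ : ∀ f → ⟨1+x+x²⟩ f ≗ ⟨1+x⟩ (⟨1+x⟩ f) ⊖ ⟨x⟩ f
⟨1+x+x²⟩≗⟨1+x⟩²⊖⟨x⟩ f k =
  trans (add-cancel (f k) (⟨x⟩ f k) (⟨x⟩ (⟨x⟩ f) k))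
        (cong (λ t → f k + ⟨x⟩ f k + t - ⟨x⟩ f k) (sym (⟨x⟩-⊕ f (⟨x⟩ f) k)))
  where
  add-cancel : ∀ a b c → a + b + c ≡ a + b + (b + c) - b
  add-cancel = solve-∀

⟨1+x⟩²⊕⟨1+x²⟩ : ∀ f → ⟨1+x⟩ (⟨1+x⟩ f) ⊕ ⟨1+x²⟩ f ≗ + 2 · ⟨1+x+x²⟩ f
⟨1+x⟩²⊕⟨1+x²⟩ f k =
  trans (cong (λ t → f k + ⟨x⟩ f k + t + ⟨1+x²⟩ f k) (⟨x⟩-⊕ f (⟨x⟩ f) k))
        (regroup (f k) (⟨x⟩ f k) (⟨x⟩ (⟨x⟩ f) k))
  where
  regroup : ∀ a b c → a + b + (b + c) + (a + c) ≡ + 2 * (a + b + c)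
  regroup = solve-∀

⟨1-x⟩-⊕ : ∀ f g → ⟨1-x⟩ (f ⊕ g) ≗ ⟨1-x⟩ f ⊕ ⟨1-x⟩ g
⟨1-x⟩-⊕ f g k = trans (cong (_-_ (f k + g k)) (⟨x⟩-⊕ f g k)) (rearrange (f k) (g k) (⟨x⟩ f k) (⟨x⟩ g k))
  where
  rearrange : ∀ a b c d → a + b - (c + d) ≡ a - c + (b - d)
  rearrange = solve-∀

⟨1-x⟩-⟨x⟩ : ∀ f → ⟨1-x⟩ (⟨x⟩ f) ≗ ⟨x⟩ (⟨1-x⟩ f)
⟨1-x⟩-⟨x⟩ f zero    = refl
⟨1-x⟩-⟨x⟩ f (suc k) = refl

⟨1-x⟩-⟨1+x⟩ : ∀ f → ⟨1-x⟩ (⟨1+x⟩ f) ≗ ⟨1+x⟩ (⟨1-x⟩ f)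
⟨1-x⟩-⟨1+x⟩ f k = trans (⟨1-x⟩-⊕ f (⟨x⟩ f) k) (cong (_+_ (⟨1-x⟩ f k)) (⟨1-x⟩-⟨x⟩ f k))

⟨1-x⟩-⟨1+x²⟩ : ∀ f → ⟨1-x⟩ (⟨1+x²⟩ f) ≗ ⟨1+x²⟩ (⟨1-x⟩ f)
⟨1-x⟩-⟨1+x²⟩ f k = trans (⟨1-x⟩-⊕ f (⟨x⟩ (⟨x⟩ f)) k)
  (cong (_+_ (⟨1-x⟩ f k)) (trans (⟨1-x⟩-⟨x⟩ (⟨x⟩ f) k) (⟨x⟩-cong (⟨1-x⟩-⟨x⟩ f) k)))

lincomb : ℕ → (ℕ → ℤ) → (ℕ → Seq) → Seq
lincomb b w F k = sumUpToℤ b (λ j → w j * F j k)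

lincomb-cong : ∀ b w {F G} → (∀ j → j ≤ b → F j ≗ G j) → lincomb b w F ≗ lincomb b w G
lincomb-cong b w F≗G k = sumUpToℤ-cong b (λ j j≤b → cong (w j *_) (F≗G j j≤b k))

lincomb-⊕ : ∀ b w F G → lincomb b w (λ j → F j ⊕ G j) ≗ lincomb b w F ⊕ lincomb b w G
lincomb-⊕ b w F G k = trans (sumUpToℤ-cong b (λ j _ → ℤ.*-distribˡ-+ (w j) (F j k) (G j k)))
                            (sumUpToℤ-+ b (λ j → w j * F j k) (λ j → w j * G j k))

lincomb-· : ∀ b w c F → lincomb b w (λ j → c · F j) ≗ c · lincomb b w F
lincomb-· b w c F k = trans (sumUpToℤ-cong b (λ j _ → x*[y*z]≡y*[x*z] (w j) c (F j k)))
                            (sumUpToℤ-* b c (λ j → w j * F j k))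
  where
  x*[y*z]≡y*[x*z] : ∀ x y z → x * (y * z) ≡ y * (x * z)
  x*[y*z]≡y*[x*z] = solve-∀

lincomb-⟨x⟩ : ∀ b w F → lincomb b w (λ j → ⟨x⟩ (F j)) ≗ ⟨x⟩ (lincomb b w F)
lincomb-⟨x⟩ b w F zero    = trans (sumUpToℤ-cong b (λ j _ → ℤ.*-zeroʳ (w j))) (sumUpToℤ-zero b)
lincomb-⟨x⟩ b w F (suc k) = refl

lincomb-⟨1+x+x²⟩ : ∀ b w F → lincomb b w (λ j → ⟨1+x+x²⟩ (F j)) ≗ ⟨1+x+x²⟩ (lincomb b w F)
lincomb-⟨1+x+x²⟩ b w F k = begin
  lincomb b w (λ j → ⟨1+x+x²⟩ (F j)) k
    ≡⟨ lincomb-⊕ b w (λ j → ⟨1+x⟩ (F j)) (λ j → ⟨x⟩ (⟨x⟩ (F j))) k ⟩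
  lincomb b w (λ j → ⟨1+x⟩ (F j)) k + lincomb b w (λ j → ⟨x⟩ (⟨x⟩ (F j))) k
    ≡⟨ cong₂ _+_ (lincomb-⊕ b w F (λ j → ⟨x⟩ (F j)) k)
                 (trans (lincomb-⟨x⟩ b w (λ j → ⟨x⟩ (F j)) k) (⟨x⟩-cong (lincomb-⟨x⟩ b w F) k)) ⟩
  lincomb b w F k + lincomb b w (λ j → ⟨x⟩ (F j)) k + ⟨x⟩ (⟨x⟩ (lincomb b w F)) k
    ≡⟨ cong (λ t → lincomb b w F k + t + ⟨x⟩ (⟨x⟩ (lincomb b w F)) k) (lincomb-⟨x⟩ b w F k) ⟩
  ⟨1+x+x²⟩ (lincomb b w F) k ∎
  where open ≡-Reasoning

binomWeight : ℕ → ℕ → ℤ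
binomWeight i j = + (i C j)

lincomb-pascal : ∀ i F → lincomb (suc i) (binomWeight (suc i)) F
                         ≗ lincomb i (binomWeight i) F ⊕ lincomb i (binomWeight i) (λ j → F (suc j))
lincomb-pascal i F k = begin
  sumUpToℤ (suc i) (λ j → + (suc i C j) * F j k)
    ≡⟨ sumUpToℤ-peel i _ ⟩
  + 1 * F 0 k + sumUpToℤ i (λ j → + (suc i C suc j) * F (suc j) k)
    ≡⟨ cong (_+_ (+ 1 * F 0 k)) (sumUpToℤ-cong i (λ j _ → split j)) ⟩
  + 1 * F 0 k + sumUpToℤ i (λ j → u j + v j)
    ≡⟨ cong (_+_ (+ 1 * F 0 k)) (sumUpToℤ-+ i u v) ⟩
  + 1 * F 0 k + (sumUpToℤ i u + sumUpToℤ i v)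
    ≡⟨ ℤ.+-assoc (+ 1 * F 0 k) (sumUpToℤ i u) (sumUpToℤ i v) ⟨
  + 1 * F 0 k + sumUpToℤ i u + sumUpToℤ i v
    ≡⟨ cong (_+ sumUpToℤ i v) absorb-first ⟩
  sumUpToℤ i (λ j → + (i C j) * F j k) + sumUpToℤ i v ∎
  where
  open ≡-Reasoning
  u v : ℕ → ℤ
  u j = + (i C suc j) * F (suc j) k
  v j = + (i C j) * F (suc j) k
  split : ∀ j → + (suc i C suc j) * F (suc j) k ≡ u j + v j
  split j = begin
    + (suc i C suc j) * F (suc j) k               ≡⟨ cong (λ c → + c * F (suc j) k) (nCk+nC[k+1]≡[n+1]C[k+1] i j) ⟨
    + (i C j ℕ.+ i C suc j) * F (suc j) k         ≡⟨ cong (_* F (suc j) k) (ℤ.pos-+ (i C j) (i C suc j)) ⟩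
    (+ (i C j) + + (i C suc j)) * F (suc j) k     ≡⟨ ℤ.*-distribʳ-+ (F (suc j) k) (+ (i C j)) (+ (i C suc j)) ⟩
    v j + u j                                     ≡⟨ ℤ.+-comm (v j) (u j) ⟩
    u j + v j                                     ∎
  absorb-first : + 1 * F 0 k + sumUpToℤ i u ≡ sumUpToℤ i (λ j → + (i C j) * F j k)
  absorb-first = begin
    + 1 * F 0 k + sumUpToℤ i u                             ≡⟨ sumUpToℤ-peel i (λ j → + (i C j) * F j k) ⟨
    sumUpToℤ (suc i) (λ j → + (i C j) * F j k)
      ≡⟨ cong (λ c → sumUpToℤ i (λ j → + (i C j) * F j k) + + c * F (suc i) k)
              (trans (C≡binom i (suc i)) (binom-above i (suc i) (ℕ.n<1+n i))) ⟩
    sumUpToℤ i (λ j → + (i C j) * F j k) + 0ℤ              ≡⟨ ℤ.+-identityʳ _ ⟩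
    sumUpToℤ i (λ j → + (i C j) * F j k)                   ∎

binomℤ : ℕ → Seq
binomℤ n k = + binom n k

binomℤ-suc : ∀ n → binomℤ (suc n) ≗ ⟨1+x⟩ (binomℤ n)
binomℤ-suc n zero    = refl
binomℤ-suc n (suc k) =
  trans (ℤ.pos-+ (binom n k) (binom n (suc k))) (ℤ.+-comm (+ binom n k) (+ binom n (suc k)))

-- conv₂ a b k = Σ_{2m ≤ k} a m * b (k - 2m), the coefficient of x^k in a(x²) b(x).
conv₂ : Seq → Seq → Seq
conv₂ a b zero          = a 0 * b 0
conv₂ a b (suc zero)    = a 0 * b 1
conv₂ a b (suc (suc k)) = a 0 * b (suc (suc k)) + conv₂ (λ m → a (suc m)) b k

conv₂-sum : ∀ a b k → sumUpToℤ ⌊ k /2⌋ (λ m → a m * b (k ∸ 2 ℕ.* m)) ≡ conv₂ a b k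
conv₂-sum a b zero          = refl
conv₂-sum a b (suc zero)    = refl
conv₂-sum a b (suc (suc k)) = begin
  sumUpToℤ ⌊ suc (suc k) /2⌋ (λ m → a m * b (suc (suc k) ∸ 2 ℕ.* m))
    ≡⟨ sumUpToℤ-peel ⌊ k /2⌋ _ ⟩
  a 0 * b (suc (suc k)) + sumUpToℤ ⌊ k /2⌋ (λ m → a (suc m) * b (suc (suc k) ∸ 2 ℕ.* suc m))
    ≡⟨ cong (_+_ (a 0 * b (suc (suc k)))) (sumUpToℤ-cong ⌊ k /2⌋ λ m _ →
         cong (λ t → a (suc m) * b (suc (suc k) ∸ t)) (ℕ.*-suc 2 m)) ⟩
  a 0 * b (suc (suc k)) + sumUpToℤ ⌊ k /2⌋ (λ m → a (suc m) * b (k ∸ 2 ℕ.* m))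
    ≡⟨ cong (_+_ (a 0 * b (suc (suc k)))) (conv₂-sum (λ m → a (suc m)) b k) ⟩
  conv₂ a b (suc (suc k)) ∎
  where open ≡-Reasoning

conv₂-cong : ∀ {a a′ b b′} → a ≗ a′ → b ≗ b′ → conv₂ a b ≗ conv₂ a′ b′
conv₂-cong a≗a′ b≗b′ zero          = cong₂ _*_ (a≗a′ 0) (b≗b′ 0)
conv₂-cong a≗a′ b≗b′ (suc zero)    = cong₂ _*_ (a≗a′ 0) (b≗b′ 1)
conv₂-cong a≗a′ b≗b′ (suc (suc k)) =
  cong₂ _+_ (cong₂ _*_ (a≗a′ 0) (b≗b′ (suc (suc k)))) (conv₂-cong (λ m → a≗a′ (suc m)) b≗b′ k)

conv₂-⊕ˡ : ∀ a a′ b → conv₂ (a ⊕ a′) b ≗ conv₂ a b ⊕ conv₂ a′ b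
conv₂-⊕ˡ a a′ b zero          = ℤ.*-distribʳ-+ (b 0) (a 0) (a′ 0)
conv₂-⊕ˡ a a′ b (suc zero)    = ℤ.*-distribʳ-+ (b 1) (a 0) (a′ 0)
conv₂-⊕ˡ a a′ b (suc (suc k)) =
  trans (cong₂ _+_ (ℤ.*-distribʳ-+ (b (suc (suc k))) (a 0) (a′ 0))
                   (conv₂-⊕ˡ (λ m → a (suc m)) (λ m → a′ (suc m)) b k))
        (+-medial (a 0 * b (suc (suc k))) _ (conv₂ (λ m → a (suc m)) b k) _)

conv₂-⊕ʳ : ∀ a b b′ → conv₂ a (b ⊕ b′) ≗ conv₂ a b ⊕ conv₂ a b′
conv₂-⊕ʳ a b b′ zero          = ℤ.*-distribˡ-+ (a 0) (b 0) (b′ 0)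
conv₂-⊕ʳ a b b′ (suc zero)    = ℤ.*-distribˡ-+ (a 0) (b 1) (b′ 1)
conv₂-⊕ʳ a b b′ (suc (suc k)) =
  trans (cong₂ _+_ (ℤ.*-distribˡ-+ (a 0) (b (suc (suc k))) (b′ (suc (suc k))))
                   (conv₂-⊕ʳ (λ m → a (suc m)) b b′ k))
        (+-medial (a 0 * b (suc (suc k))) _ (conv₂ (λ m → a (suc m)) b k) _)

conv₂-⟨x⟩ˡ : ∀ a b → conv₂ (⟨x⟩ a) b ≗ ⟨x⟩ (⟨x⟩ (conv₂ a b))
conv₂-⟨x⟩ˡ a b zero          = refl
conv₂-⟨x⟩ˡ a b (suc zero)    = refl
conv₂-⟨x⟩ˡ a b (suc (suc k)) = ℤ.+-identityˡ (conv₂ a b k)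

conv₂-⟨x⟩ʳ : ∀ a b → conv₂ a (⟨x⟩ b) ≗ ⟨x⟩ (conv₂ a b)
conv₂-⟨x⟩ʳ a b zero                = ℤ.*-zeroʳ (a 0)
conv₂-⟨x⟩ʳ a b (suc zero)          = refl
conv₂-⟨x⟩ʳ a b (suc (suc zero))    =
  trans (cong (_+_ (a 0 * b 1)) (conv₂-⟨x⟩ʳ (λ m → a (suc m)) b 0)) (ℤ.+-identityʳ _)
conv₂-⟨x⟩ʳ a b (suc (suc (suc k))) =
  cong (_+_ (a 0 * b (suc (suc k)))) (conv₂-⟨x⟩ʳ (λ m → a (suc m)) b (suc k))

conv₂-unitˡ : ∀ b → conv₂ (binomℤ 0) b ≗ b
conv₂-unitˡ b zero          = ℤ.*-identityˡ (b 0)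
conv₂-unitˡ b (suc zero)    = ℤ.*-identityˡ (b 1)
conv₂-unitˡ b (suc (suc k)) = begin
  + 1 * b (suc (suc k)) + conv₂ (λ _ → 0ℤ) b k ≡⟨ cong₂ _+_ (ℤ.*-identityˡ (b (suc (suc k)))) (conv₂-zeroˡ k) ⟩
  b (suc (suc k)) + 0ℤ                          ≡⟨ ℤ.+-identityʳ _ ⟩
  b (suc (suc k))                               ∎
  where
  open ≡-Reasoning
  conv₂-zeroˡ : ∀ k → conv₂ (λ _ → 0ℤ) b k ≡ 0ℤ
  conv₂-zeroˡ zero          = refl
  conv₂-zeroˡ (suc zero)    = refl
  conv₂-zeroˡ (suc (suc k)) = trans (ℤ.+-identityˡ _) (conv₂-zeroˡ k)

fixedSubsetsℤ : ℕ → ℕ → Seq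
fixedSubsetsℤ n j k = + fixedSubsets n k j

fixedSubsetsℤ≗conv₂ : ∀ n j → fixedSubsetsℤ n j ≗ conv₂ (binomℤ j) (binomℤ (n ∸ 2 ℕ.* j))
fixedSubsetsℤ≗conv₂ n j k = begin
  + fixedSubsets n k j
    ≡⟨ +-sumUpTo ⌊ k /2⌋ _ ⟩
  sumUpToℤ ⌊ k /2⌋ (λ m → + ((j C m) ℕ.* ((n ∸ 2 ℕ.* j) C (k ∸ 2 ℕ.* m))))
    ≡⟨ sumUpToℤ-cong ⌊ k /2⌋ (λ m _ → trans
         (cong₂ (λ a b → + (a ℕ.* b)) (C≡binom j m) (C≡binom (n ∸ 2 ℕ.* j) (k ∸ 2 ℕ.* m)))
         (ℤ.pos-* (binom j m) _)) ⟩
  sumUpToℤ ⌊ k /2⌋ (λ m → binomℤ j m * binomℤ (n ∸ 2 ℕ.* j) (k ∸ 2 ℕ.* m))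
    ≡⟨ conv₂-sum (binomℤ j) (binomℤ (n ∸ 2 ℕ.* j)) k ⟩
  conv₂ (binomℤ j) (binomℤ (n ∸ 2 ℕ.* j)) k ∎
  where open ≡-Reasoning

fixedSubsetsℤ-zero : ∀ n → fixedSubsetsℤ n 0 ≗ binomℤ n
fixedSubsetsℤ-zero n k = trans (fixedSubsetsℤ≗conv₂ n 0 k) (conv₂-unitˡ (binomℤ n) k)

fixedSubsetsℤ-suc : ∀ n j → 2 ℕ.* j ≤ n → fixedSubsetsℤ (suc n) j ≗ ⟨1+x⟩ (fixedSubsetsℤ n j)
fixedSubsetsℤ-suc n j 2j≤n k = begin
  fixedSubsetsℤ (suc n) j k                       ≡⟨ fixedSubsetsℤ≗conv₂ (suc n) j k ⟩
  conv₂ a (binomℤ (suc n ∸ 2 ℕ.* j)) k     ≡⟨ cong (λ m → conv₂ a (binomℤ m) k) (ℕ.+-∸-assoc 1 2j≤n) ⟩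
  conv₂ a (binomℤ (suc m)) k               ≡⟨ conv₂-cong (λ _ → refl) (binomℤ-suc m) k ⟩
  conv₂ a (⟨1+x⟩ b) k                      ≡⟨ conv₂-⊕ʳ a b (⟨x⟩ b) k ⟩
  conv₂ a b k + conv₂ a (⟨x⟩ b) k          ≡⟨ cong (_+_ (conv₂ a b k)) (conv₂-⟨x⟩ʳ a b k) ⟩
  conv₂ a b k + ⟨x⟩ (conv₂ a b) k          ≡⟨ cong₂ _+_ (fixedSubsetsℤ≗conv₂ n j k) (⟨x⟩-cong (fixedSubsetsℤ≗conv₂ n j) k) ⟨
  ⟨1+x⟩ (fixedSubsetsℤ n j) k                     ∎
  where
  open ≡-Reasoning
  m = n ∸ 2 ℕ.* j
  a = binomℤ j
  b = binomℤ m

fixedSubsetsℤ-suc-suc : ∀ n j → fixedSubsetsℤ (suc (suc n)) (suc j) ≗ ⟨1+x²⟩ (fixedSubsetsℤ n j)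
fixedSubsetsℤ-suc-suc n j k = begin
  fixedSubsetsℤ (suc (suc n)) (suc j) k                   ≡⟨ fixedSubsetsℤ≗conv₂ (suc (suc n)) (suc j) k ⟩
  conv₂ (binomℤ (suc j)) (binomℤ (suc (suc n) ∸ 2 ℕ.* suc j)) k
    ≡⟨ cong (λ t → conv₂ (binomℤ (suc j)) (binomℤ (suc (suc n) ∸ t)) k) (ℕ.*-suc 2 j) ⟩
  conv₂ (binomℤ (suc j)) b k                       ≡⟨ conv₂-cong (binomℤ-suc j) (λ _ → refl) k ⟩
  conv₂ (⟨1+x⟩ a) b k                              ≡⟨ conv₂-⊕ˡ a (⟨x⟩ a) b k ⟩
  conv₂ a b k + conv₂ (⟨x⟩ a) b k                  ≡⟨ cong (_+_ (conv₂ a b k)) (conv₂-⟨x⟩ˡ a b k) ⟩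
  conv₂ a b k + ⟨x⟩ (⟨x⟩ (conv₂ a b)) k
    ≡⟨ cong₂ _+_ (fixedSubsetsℤ≗conv₂ n j k) (⟨x⟩-cong (⟨x⟩-cong (fixedSubsetsℤ≗conv₂ n j)) k) ⟨
  ⟨1+x²⟩ (fixedSubsetsℤ n j) k                            ∎
  where
  open ≡-Reasoning
  a = binomℤ j
  b = binomℤ (n ∸ 2 ℕ.* j)

χseq : ℕ → ℕ → Seq
χseq n j k = χ n k j

χseq≗⟨1-x⟩fixedSubsetsℤ : ∀ n j → χseq n j ≗ ⟨1-x⟩ (fixedSubsetsℤ n j)
χseq≗⟨1-x⟩fixedSubsetsℤ n j zero    = sym (ℤ.+-identityʳ _)
χseq≗⟨1-x⟩fixedSubsetsℤ n j (suc k) = refl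

χseq-suc : ∀ n j → 2 ℕ.* j ≤ n → χseq (suc n) j ≗ ⟨1+x⟩ (χseq n j)
χseq-suc n j 2j≤n k = begin
  χseq (suc n) j k                 ≡⟨ χseq≗⟨1-x⟩fixedSubsetsℤ (suc n) j k ⟩
  ⟨1-x⟩ (fixedSubsetsℤ (suc n) j) k       ≡⟨ ⟨1-x⟩-cong (fixedSubsetsℤ-suc n j 2j≤n) k ⟩
  ⟨1-x⟩ (⟨1+x⟩ (fixedSubsetsℤ n j)) k     ≡⟨ ⟨1-x⟩-⟨1+x⟩ (fixedSubsetsℤ n j) k ⟩
  ⟨1+x⟩ (⟨1-x⟩ (fixedSubsetsℤ n j)) k     ≡⟨ ⟨1+x⟩-cong (χseq≗⟨1-x⟩fixedSubsetsℤ n j) k ⟨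
  ⟨1+x⟩ (χseq n j) k               ∎
  where open ≡-Reasoning

χseq-suc-suc : ∀ n j → χseq (suc (suc n)) (suc j) ≗ ⟨1+x²⟩ (χseq n j)
χseq-suc-suc n j k = begin
  χseq (suc (suc n)) (suc j) k               ≡⟨ χseq≗⟨1-x⟩fixedSubsetsℤ (suc (suc n)) (suc j) k ⟩
  ⟨1-x⟩ (fixedSubsetsℤ (suc (suc n)) (suc j)) k     ≡⟨ ⟨1-x⟩-cong (fixedSubsetsℤ-suc-suc n j) k ⟩
  ⟨1-x⟩ (⟨1+x²⟩ (fixedSubsetsℤ n j)) k              ≡⟨ ⟨1-x⟩-⟨1+x²⟩ (fixedSubsetsℤ n j) k ⟩
  ⟨1+x²⟩ (⟨1-x⟩ (fixedSubsetsℤ n j)) k              ≡⟨ ⟨1+x²⟩-cong (χseq≗⟨1-x⟩fixedSubsetsℤ n j) k ⟨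
  ⟨1+x²⟩ (χseq n j) k                        ∎
  where open ≡-Reasoning

χseq-pair : ∀ n j → 2 ℕ.* j ≤ n →
            χseq (suc (suc n)) j ⊕ χseq (suc (suc n)) (suc j) ≗ + 2 · ⟨1+x+x²⟩ (χseq n j)
χseq-pair n j 2j≤n k = trans
  (cong₂ _+_ (trans (χseq-suc (suc n) j (ℕ.m≤n⇒m≤1+n 2j≤n) k) (⟨1+x⟩-cong (χseq-suc n j 2j≤n) k))
             (χseq-suc-suc n j k))
  (⟨1+x⟩²⊕⟨1+x²⟩ (χseq n j) k)

binomialSum : ℕ → ℕ → Seq
binomialSum n i = lincomb i (binomWeight i) (χseq n)

binomialSum-step : ∀ n i → 2 ℕ.* i ≤ n →
                   binomialSum (suc (suc n)) (suc i) ≗ + 2 · ⟨1+x+x²⟩ (binomialSum n i)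
binomialSum-step n i 2i≤n k = begin
  binomialSum (suc (suc n)) (suc i) k
    ≡⟨ lincomb-pascal i (χseq (suc (suc n))) k ⟩
  lincomb i w (χseq (suc (suc n))) k + lincomb i w (λ j → χseq (suc (suc n)) (suc j)) k
    ≡⟨ lincomb-⊕ i w (χseq (suc (suc n))) (λ j → χseq (suc (suc n)) (suc j)) k ⟨
  lincomb i w (λ j → χseq (suc (suc n)) j ⊕ χseq (suc (suc n)) (suc j)) k
    ≡⟨ lincomb-cong i w (λ j j≤i → χseq-pair n j (ℕ.≤-trans (ℕ.*-monoʳ-≤ 2 j≤i) 2i≤n)) k ⟩
  lincomb i w (λ j → + 2 · ⟨1+x+x²⟩ (χseq n j)) k
    ≡⟨ lincomb-· i w (+ 2) (λ j → ⟨1+x+x²⟩ (χseq n j)) k ⟩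
  + 2 * lincomb i w (λ j → ⟨1+x+x²⟩ (χseq n j)) k
    ≡⟨ cong (+ 2 *_) (lincomb-⟨1+x+x²⟩ i w (χseq n) k) ⟩
  + 2 * ⟨1+x+x²⟩ (binomialSum n i) k ∎
  where
  open ≡-Reasoning
  w = binomWeight i

ballot : ℕ → Seq
ballot m = χseq m 0

-- αℤ m i k is the integer α_{m+2i,k,i}.
αℤ : ℕ → ℕ → Seq
αℤ m i = fold (ballot m) ⟨1+x+x²⟩ i

binomialSum≗αℤ : ∀ i m → binomialSum (2 ℕ.* i ℕ.+ m) i ≗ + (2 ℕ.^ i) · αℤ m i
binomialSum≗αℤ zero    m k = refl
binomialSum≗αℤ (suc i) m k = begin
  binomialSum (2 ℕ.* suc i ℕ.+ m) (suc i) k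
    ≡⟨ cong (λ n → binomialSum (n ℕ.+ m) (suc i) k) (ℕ.*-suc 2 i) ⟩
  binomialSum (suc (suc (2 ℕ.* i ℕ.+ m))) (suc i) k
    ≡⟨ binomialSum-step (2 ℕ.* i ℕ.+ m) i (ℕ.m≤m+n (2 ℕ.* i) m) k ⟩
  + 2 * ⟨1+x+x²⟩ (binomialSum (2 ℕ.* i ℕ.+ m) i) k
    ≡⟨ cong (+ 2 *_) (⟨1+x+x²⟩-cong (binomialSum≗αℤ i m) k) ⟩
  + 2 * ⟨1+x+x²⟩ (+ (2 ℕ.^ i) · αℤ m i) k
    ≡⟨ cong (+ 2 *_) (⟨1+x+x²⟩-· (+ (2 ℕ.^ i)) (αℤ m i) k) ⟩
  + 2 * (+ (2 ℕ.^ i) * αℤ m (suc i) k)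
    ≡⟨ ℤ.*-assoc (+ 2) (+ (2 ℕ.^ i)) (αℤ m (suc i) k) ⟨
  + 2 * + (2 ℕ.^ i) * αℤ m (suc i) k
    ≡⟨ cong (_* αℤ m (suc i) k) (ℤ.pos-* 2 (2 ℕ.^ i)) ⟨
  + (2 ℕ.^ suc i) * αℤ m (suc i) k ∎
  where open ≡-Reasoning

record Antipalindromic (K : ℕ) (f : Seq) : Set where
  field
    reflect : ∀ p q → p ℕ.+ q ≡ K → f p + f q ≡ 0ℤ
    vanish  : ∀ p → K < p → f p ≡ 0ℤ

open Antipalindromic

antipalindromic-cong : ∀ {K f g} → f ≗ g → Antipalindromic K f → Antipalindromic K g
antipalindromic-cong f≗g A = record
  { reflect = λ p q p+q≡K → trans (cong₂ _+_ (sym (f≗g p)) (sym (f≗g q))) (reflect A p q p+q≡K)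
  ; vanish  = λ p K<p → trans (sym (f≗g p)) (vanish A p K<p)
  }

antipalindromic-⊖ : ∀ {K f g} → Antipalindromic K f → Antipalindromic K g → Antipalindromic K (f ⊖ g)
antipalindromic-⊖ {f = f} {g} A B = record
  { reflect = λ p q p+q≡K → trans (interchange (f p) (g p) (f q) (g q))
                                  (cong₂ _-_ (reflect A p q p+q≡K) (reflect B p q p+q≡K))
  ; vanish  = λ p K<p → cong₂ _-_ (vanish A p K<p) (vanish B p K<p)
  }
  where
  interchange : ∀ a b c d → a - b + (c - d) ≡ a + c - (b + d)
  interchange = solve-∀

antipalindromic-⟨x⟩ : ∀ {K f} → Antipalindromic K f → Antipalindromic (suc (suc K)) (⟨x⟩ f)
antipalindromic-⟨x⟩ {K} {f} A = record { reflect = reflect′ ; vanish = vanish′ }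
  where
  reflect′ : ∀ p q → p ℕ.+ q ≡ suc (suc K) → ⟨x⟩ f p + ⟨x⟩ f q ≡ 0ℤ
  reflect′ zero    q       refl = trans (ℤ.+-identityˡ _) (vanish A (suc K) (ℕ.n<1+n K))
  reflect′ (suc p) zero    eq   =
    trans (ℤ.+-identityʳ _) (vanish A p (ℕ.≤-reflexive (sym (ℕ.suc-injective (trans (sym (ℕ.+-identityʳ _)) eq)))))
  reflect′ (suc p) (suc q) eq   =
    reflect A p q (ℕ.suc-injective (trans (sym (ℕ.+-suc p q)) (ℕ.suc-injective eq)))
  vanish′ : ∀ p → suc (suc K) < p → ⟨x⟩ f p ≡ 0ℤ
  vanish′ (suc p) (s≤s K+2≤p) = vanish A p (ℕ.<⇒≤ K+2≤p)

antipalindromic-⟨1+x⟩ : ∀ {K f} → Antipalindromic K f → Antipalindromic (suc K) (⟨1+x⟩ f)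
antipalindromic-⟨1+x⟩ {K} {f} A = record { reflect = reflect′ ; vanish = vanish′ }
  where
  reflect₀ : ∀ q → q ≡ suc K → ⟨1+x⟩ f 0 + ⟨1+x⟩ f q ≡ 0ℤ
  reflect₀ q refl = begin
    f 0 + 0ℤ + (f (suc K) + f K)  ≡⟨ cong₂ (λ s t → s + (t + f K)) (ℤ.+-identityʳ (f 0)) (vanish A (suc K) (ℕ.n<1+n K)) ⟩
    f 0 + (0ℤ + f K)              ≡⟨ cong (_+_ (f 0)) (ℤ.+-identityˡ (f K)) ⟩
    f 0 + f K                     ≡⟨ reflect A 0 K refl ⟩
    0ℤ                            ∎
    where open ≡-Reasoning
  reflect′ : ∀ p q → p ℕ.+ q ≡ suc K → ⟨1+x⟩ f p + ⟨1+x⟩ f q ≡ 0ℤ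
  reflect′ zero    q       eq = reflect₀ q eq
  reflect′ (suc p) zero    eq =
    trans (ℤ.+-comm (⟨1+x⟩ f (suc p)) _) (reflect₀ (suc p) (trans (sym (ℕ.+-identityʳ _)) eq))
  reflect′ (suc p) (suc q) eq = begin
    f (suc p) + f p + (f (suc q) + f q)   ≡⟨ medial′ (f (suc p)) (f p) (f (suc q)) (f q) ⟩
    f (suc p) + f q + (f p + f (suc q))   ≡⟨ cong₂ _+_ (reflect A (suc p) q p+1+q≡K) (reflect A p (suc q) p+q+1≡K) ⟩
    0ℤ                                    ∎
    where
    open ≡-Reasoning
    p+q+1≡K : p ℕ.+ suc q ≡ K
    p+q+1≡K = ℕ.suc-injective eq
    p+1+q≡K : suc p ℕ.+ q ≡ K
    p+1+q≡K = trans (sym (ℕ.+-suc p q)) p+q+1≡K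
    medial′ : ∀ a b c d → a + b + (c + d) ≡ a + d + (b + c)
    medial′ = solve-∀
  vanish′ : ∀ p → suc K < p → ⟨1+x⟩ f p ≡ 0ℤ
  vanish′ (suc p) (s≤s K<p) = cong₂ _+_ (vanish A (suc p) (ℕ.m<n⇒m<1+n K<p)) (vanish A p K<p)

antipalindromic-⟨1+x+x²⟩ : ∀ {K f} → Antipalindromic K f → Antipalindromic (suc (suc K)) (⟨1+x+x²⟩ f)
antipalindromic-⟨1+x+x²⟩ {f = f} A =
  antipalindromic-cong (λ k → sym (⟨1+x+x²⟩≗⟨1+x⟩²⊖⟨x⟩ f k))
    (antipalindromic-⊖ (antipalindromic-⟨1+x⟩ (antipalindromic-⟨1+x⟩ A)) (antipalindromic-⟨x⟩ A))

antipalindromic-middle : ∀ {c f} → Antipalindromic (suc (suc (2 ℕ.* c))) f → f (suc c) ≡ 0ℤ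
antipalindromic-middle {c} {f} A = i+i≡0⇒i≡0 (f (suc c)) (reflect A (suc c) (suc c) (c+1+c+1 c))
  where
  c+1+c+1 : ∀ c → suc c ℕ.+ suc c ≡ suc (suc (2 ℕ.* c))
  c+1+c+1 = ℕ-Solver.solve-∀
  i+i≡0⇒i≡0 : ∀ i → i + i ≡ 0ℤ → i ≡ 0ℤ
  i+i≡0⇒i≡0 (+ zero)    _  = refl
  i+i≡0⇒i≡0 (+ suc n)   ()
  i+i≡0⇒i≡0 -[1+ n ]    ()

0≤+ : ∀ {n} → 0ℤ ℤ.≤ + n
0≤+ = ℤ.+≤+ z≤n

0<+suc : ∀ {n} → 0ℤ ℤ.< + suc n
0<+suc = ℤ.+<+ (s≤s z≤n)

+-nonNeg : ∀ {i j} → 0ℤ ℤ.≤ i → 0ℤ ℤ.≤ j → 0ℤ ℤ.≤ i + j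
+-nonNeg = ℤ.+-mono-≤

+-pos : ∀ {i j} → 0ℤ ℤ.≤ i → 0ℤ ℤ.< j → 0ℤ ℤ.< i + j
+-pos = ℤ.+-mono-≤-<

*-nonNeg : ∀ {i j} → 0ℤ ℤ.≤ i → 0ℤ ℤ.≤ j → 0ℤ ℤ.≤ i * j
*-nonNeg {+ m} {+ n} _ _ = subst (0ℤ ℤ.≤_) (ℤ.pos-* m n) 0≤+

*-pos : ∀ {i j} → 0ℤ ℤ.< i → 0ℤ ℤ.< j → 0ℤ ℤ.< i * j
*-pos {+ suc m} {+ suc n} _            _            = 0<+suc
*-pos {+ zero}  {_}       (ℤ.+<+ ()) _
*-pos {_}       {+ zero}  _            (ℤ.+<+ ())

*-cancelʳ-nonNeg : ∀ {i k} → 0ℤ ℤ.< k → 0ℤ ℤ.≤ i * k → 0ℤ ℤ.≤ i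
*-cancelʳ-nonNeg {i} {k} 0<k = ℤ.*-cancelʳ-≤-pos 0ℤ i k {{ℤ.positive 0<k}}

*-cancelʳ-pos : ∀ {i k} → 0ℤ ℤ.≤ k → 0ℤ ℤ.< i * k → 0ℤ ℤ.< i
*-cancelʳ-pos {i} {k} 0≤k = ℤ.*-cancelʳ-<-nonNeg k {{ℤ.nonNegative 0≤k}}

≤-by-multiple : ∀ {x y P} → 0ℤ ℤ.< P → 0ℤ ℤ.≤ (y - x) * P → x ℤ.≤ y
≤-by-multiple 0<P 0≤[y-x]P = ℤ.0≤i-j⇒j≤i (*-cancelʳ-nonNeg 0<P 0≤[y-x]P)

NonNegUpTo : ℕ → Seq → Set
NonNegUpTo c f = ∀ k → k ≤ c → 0ℤ ℤ.≤ f k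

NonNegUpTo-⟨x⟩ : ∀ {c f} → NonNegUpTo c f → NonNegUpTo c (⟨x⟩ f)
NonNegUpTo-⟨x⟩ f≥0 zero    _    = ℤ.≤-refl
NonNegUpTo-⟨x⟩ f≥0 (suc k) k<c = f≥0 k (ℕ.<⇒≤ k<c)

NonNegUpTo-suc : ∀ {c f} → NonNegUpTo c f → f (suc c) ≡ 0ℤ → NonNegUpTo (suc c) f
NonNegUpTo-suc {c} f≥0 f[c+1]≡0 k k≤c+1 with ℕ.m≤n⇒m<n∨m≡n k≤c+1
... | inj₁ k<c+1 = f≥0 k (ℕ.≤-pred k<c+1)
... | inj₂ refl  = ℤ.≤-reflexive (sym f[c+1]≡0)

ballot≗⟨1-x⟩binomℤ : ∀ m → ballot m ≗ ⟨1-x⟩ (binomℤ m)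
ballot≗⟨1-x⟩binomℤ m k = trans (χseq≗⟨1-x⟩fixedSubsetsℤ m 0 k) (⟨1-x⟩-cong (fixedSubsetsℤ-zero m) k)

ballot-suc : ∀ m → ballot (suc m) ≗ ⟨1+x⟩ (ballot m)
ballot-suc m = χseq-suc m 0 z≤n

ballot-antipalindromic : ∀ m → Antipalindromic (suc m) (ballot m)
ballot-antipalindromic zero    =
  antipalindromic-cong (λ k → sym (ballot≗⟨1-x⟩binomℤ 0 k)) (record { reflect = reflect′ ; vanish = vanish′ })
  where
  reflect′ : ∀ p q → p ℕ.+ q ≡ 1 → ⟨1-x⟩ (binomℤ 0) p + ⟨1-x⟩ (binomℤ 0) q ≡ 0ℤ
  reflect′ zero          (suc zero) _ = refl
  reflect′ (suc zero)    zero       _ = refl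
  vanish′ : ∀ p → 1 < p → ⟨1-x⟩ (binomℤ 0) p ≡ 0ℤ
  vanish′ (suc zero)    (s≤s ())
  vanish′ (suc (suc p)) _ = refl
ballot-antipalindromic (suc m) =
  antipalindromic-cong (λ k → sym (ballot-suc m k)) (antipalindromic-⟨1+x⟩ (ballot-antipalindromic m))

+[k+1] : ∀ k → + suc k ≡ + k + + 1
+[k+1] k = trans (cong +_ (ℕ.+-comm 1 k)) (ℤ.pos-+ k 1)

binomℤ-absorb : ∀ n k → binomℤ n (suc k) * (+ k + + 1) + binomℤ n k * + k ≡ binomℤ n k * + n
binomℤ-absorb n k = begin
  binomℤ n (suc k) * (+ k + + 1) + binomℤ n k * + k
    ≡⟨ cong (λ t → binomℤ n (suc k) * t + binomℤ n k * + k) (+[k+1] k) ⟨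
  + binom n (suc k) * + suc k + + binom n k * + k
    ≡⟨ cong₂ _+_ (ℤ.pos-* (binom n (suc k)) (suc k)) (ℤ.pos-* (binom n k) k) ⟨
  + (binom n (suc k) ℕ.* suc k) + + (binom n k ℕ.* k)
    ≡⟨ ℤ.pos-+ (binom n (suc k) ℕ.* suc k) (binom n k ℕ.* k) ⟨
  + (binom n (suc k) ℕ.* suc k ℕ.+ binom n k ℕ.* k)
    ≡⟨ cong +_ (binom-absorb n k) ⟩
  + (binom n k ℕ.* n)
    ≡⟨ ℤ.pos-* (binom n k) n ⟩
  binomℤ n k * + n ∎
  where open ≡-Reasoning

binomℤ-absorb⁻ : ∀ n k → binomℤ n k * + k + ⟨x⟩ (binomℤ n) k * (+ k - + 1) ≡ ⟨x⟩ (binomℤ n) k * + n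
binomℤ-absorb⁻ n zero    = refl
binomℤ-absorb⁻ n (suc k) =
  trans (cong₂ (λ s t → binomℤ n (suc k) * s + binomℤ n k * t)
               (+[k+1] k) (trans (cong (_- + 1) (+[k+1] k)) (i+1-1≡i (+ k))))
        (binomℤ-absorb n k)
  where
  i+1-1≡i : ∀ i → i + + 1 - + 1 ≡ i
  i+1-1≡i = solve-∀

+[2k+e+1] : ∀ k e → + suc (2 ℕ.* k ℕ.+ e) ≡ + 2 * + k + + e + + 1
+[2k+e+1] k e = begin
  + suc (2 ℕ.* k ℕ.+ e)        ≡⟨ +[k+1] (2 ℕ.* k ℕ.+ e) ⟩
  + (2 ℕ.* k ℕ.+ e) + + 1      ≡⟨ cong (_+ + 1) (ℤ.pos-+ (2 ℕ.* k) e) ⟩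
  + (2 ℕ.* k) + + e + + 1      ≡⟨ cong (λ t → t + + e + + 1) (ℤ.pos-* 2 k) ⟩
  + 2 * + k + + e + + 1        ∎
  where open ≡-Reasoning

-- With m = 2k + e + 1, both sides equal e (e + 2) (m choose k),
-- as B_m(k) = (m choose k) (m + 1 - 2k) / (m + 1 - k).
-- K and E stand for the integers k and e, in whatever form the caller needs them.
ballot-ratio : ∀ k e {K E} → K ≡ + k → E ≡ + e → let y = ballot (suc (2 ℕ.* k ℕ.+ e)) in
               y (suc k) * (K + + 1) * (E + + 2) ≡ y k * (K + E + + 2) * E
ballot-ratio k e refl refl = ℤ.i-j≡0⇒i≡j _ _ (begin
  y (suc k) * (K + + 1) * (E + + 2) - y k * (K + E + + 2) * E
    ≡⟨ cong₂ (λ s t → s * (K + + 1) * (E + + 2) - t * (K + E + + 2) * E)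
             (ballot≗⟨1-x⟩binomℤ m (suc k)) (ballot≗⟨1-x⟩binomℤ m k) ⟩
  (a - c) * (K + + 1) * (E + + 2) - (c - c′) * (K + E + + 2) * E
    ≡⟨ identity a c c′ K E ⟩
  (E + + 2) * (a * (K + + 1) + c * K - c * M) - E * (c * K + c′ * (K - + 1) - c′ * M)
    ≡⟨ cong₂ (λ s t → (E + + 2) * s - E * t) (ℤ.i≡j⇒i-j≡0 absorb) (ℤ.i≡j⇒i-j≡0 absorb⁻) ⟩
  (E + + 2) * 0ℤ - E * 0ℤ
    ≡⟨ cong₂ _-_ (ℤ.*-zeroʳ (E + + 2)) (ℤ.*-zeroʳ E) ⟩
  0ℤ ∎)
  where
  open ≡-Reasoning
  m = suc (2 ℕ.* k ℕ.+ e)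
  y = ballot m
  K = + k
  E = + e
  M = + 2 * K + E + + 1
  a = binomℤ m (suc k)
  c = binomℤ m k
  c′ = ⟨x⟩ (binomℤ m) k
  absorb : a * (K + + 1) + c * K ≡ c * M
  absorb = trans (binomℤ-absorb m k) (cong (c *_) (+[2k+e+1] k e))
  absorb⁻ : c * K + c′ * (K - + 1) ≡ c′ * M
  absorb⁻ = trans (binomℤ-absorb⁻ m k) (cong (c′ *_) (+[2k+e+1] k e))
  identity : ∀ a c c′ K E →
    (a - c) * (K + + 1) * (E + + 2) - (c - c′) * (K + E + + 2) * E
    ≡ (E + + 2) * (a * (K + + 1) + c * K - c * (+ 2 * K + E + + 1))
      - E * (c * K + c′ * (K - + 1) - c′ * (+ 2 * K + E + + 1))
  identity = solve-∀

+[e+2] : ∀ e → + suc (suc e) ≡ + e + + 2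
+[e+2] e = trans (cong +_ (ℕ.+-comm 2 e)) (ℤ.pos-+ e 2)

ballot-ratio⁻ : ∀ k e {K E} → K ≡ + k → E ≡ + e → let y = ballot (suc (2 ℕ.* k ℕ.+ e)) in
                y k * K * (E + + 4) ≡ ⟨x⟩ y k * (K + E + + 3) * (E + + 2)
ballot-ratio⁻ zero    e refl refl = cong (_* (+ e + + 4)) (ℤ.*-zeroʳ (ballot (suc e) 0))
ballot-ratio⁻ (suc k) e refl refl = begin
  y (suc k) * + suc k * (E + + 4)                      ≡⟨ cong (λ t → y (suc k) * t * (E + + 4)) (+[k+1] k) ⟩
  y (suc k) * (K + + 1) * (E + + 4)                    ≡⟨ shuffleˡ (y (suc k)) K E ⟩
  y (suc k) * (K + + 1) * (E + + 2 + + 2)              ≡⟨ ratio ⟩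
  y k * (K + (E + + 2) + + 2) * (E + + 2)              ≡⟨ shuffleʳ (y k) K E ⟩
  y k * (K + + 1 + E + + 3) * (E + + 2)                ≡⟨ cong (λ t → y k * (t + E + + 3) * (E + + 2)) (+[k+1] k) ⟨
  y k * (+ suc k + E + + 3) * (E + + 2)                ∎
  where
  open ≡-Reasoning
  K = + k
  E = + e
  y = ballot (suc (2 ℕ.* suc k ℕ.+ e))
  ratio : y (suc k) * (K + + 1) * (E + + 2 + + 2) ≡ y k * (K + (E + + 2) + + 2) * (E + + 2)
  ratio = subst (λ m → ballot m (suc k) * (K + + 1) * (E + + 2 + + 2) ≡ ballot m k * (K + (E + + 2) + + 2) * (E + + 2))
                (level k e) (ballot-ratio k (suc (suc e)) refl (sym (+[e+2] e)))
    where
    level : ∀ k e → suc (2 ℕ.* k ℕ.+ suc (suc e)) ≡ suc (2 ℕ.* suc k ℕ.+ e)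
    level = ℕ-Solver.solve-∀
  shuffleˡ : ∀ a K E → a * (K + + 1) * (E + + 4) ≡ a * (K + + 1) * (E + + 2 + + 2)
  shuffleˡ = solve-∀
  shuffleʳ : ∀ a K E → a * (K + (E + + 2) + + 2) * (E + + 2) ≡ a * (K + + 1 + E + + 3) * (E + + 2)
  shuffleʳ = solve-∀

ballot-pos : ∀ m k → 2 ℕ.* k ≤ m → 0ℤ ℤ.< ballot m k
ballot-pos m zero    _      = subst (0ℤ ℤ.<_) (sym (ballot≗⟨1-x⟩binomℤ m 0)) 0<+suc
ballot-pos m (suc k) 2k+2≤m with ℕ.m≤n⇒∃[o]m+o≡n 2k+2≤m
... | o , 2k+2+o≡m = subst (λ m → 0ℤ ℤ.< ballot m (suc k)) level next-pos
  where
  level : suc (2 ℕ.* k ℕ.+ suc o) ≡ m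
  level = trans (reassoc k o) 2k+2+o≡m
    where
    reassoc : ∀ k o → suc (2 ℕ.* k ℕ.+ suc o) ≡ 2 ℕ.* suc k ℕ.+ o
    reassoc = ℕ-Solver.solve-∀
  y = ballot (suc (2 ℕ.* k ℕ.+ suc o))
  this-pos : 0ℤ ℤ.< y k
  this-pos = subst (λ m → 0ℤ ℤ.< ballot m k) (sym level)
               (ballot-pos m k (ℕ.≤-trans (ℕ.*-monoʳ-≤ 2 (ℕ.n≤1+n k)) 2k+2≤m))
  next-pos : 0ℤ ℤ.< y (suc k)
  next-pos = *-cancelʳ-pos (*-nonNeg {+ k + + 1} {+ suc o + + 2} 0≤+ 0≤+)
    (subst (0ℤ ℤ.<_) (trans (sym (ballot-ratio k (suc o) refl refl)) (ℤ.*-assoc (y (suc k)) (+ k + + 1) (+ suc o + + 2)))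
      (*-pos (*-pos this-pos (+-pos 0≤+ 0<+suc)) 0<+suc))

ballot-nonNeg : ∀ m k → 2 ℕ.* k ≤ m → 0ℤ ℤ.≤ ballot m k
ballot-nonNeg m k 2k≤m = ℤ.<⇒≤ (ballot-pos m k 2k≤m)

ballot-middle : ∀ c → ballot (suc (2 ℕ.* c)) (suc c) ≡ 0ℤ
ballot-middle c = antipalindromic-middle {c} (ballot-antipalindromic (suc (2 ℕ.* c)))

ballot-nonNegUpTo : ∀ c → NonNegUpTo (suc c) (ballot (suc (2 ℕ.* c)))
ballot-nonNegUpTo c = NonNegUpTo-suc (λ k k≤c → ballot-nonNeg _ k (ℕ.m≤n⇒m≤1+n (ℕ.*-monoʳ-≤ 2 k≤c))) (ballot-middle c)

ballot-⟨1+x⟩² : ∀ c → ballot (suc (2 ℕ.* suc c)) ≗ ⟨1+x⟩ (⟨1+x⟩ (ballot (suc (2 ℕ.* c))))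
ballot-⟨1+x⟩² c k = begin
  ballot (suc (2 ℕ.* suc c)) k                          ≡⟨ cong (λ m → ballot (suc m) k) (ℕ.*-suc 2 c) ⟩
  ballot (suc (suc (suc (2 ℕ.* c)))) k                  ≡⟨ ballot-suc (suc (suc (2 ℕ.* c))) k ⟩
  ⟨1+x⟩ (ballot (suc (suc (2 ℕ.* c)))) k                ≡⟨ ⟨1+x⟩-cong (ballot-suc (suc (2 ℕ.* c))) k ⟩
  ⟨1+x⟩ (⟨1+x⟩ (ballot (suc (2 ℕ.* c)))) k              ∎
  where open ≡-Reasoning

cross₁-cleared : ∀ U V u v B E → v * (B + + 1) * (E + + 2) ≡ u * (B + E + + 2) * E →
                 V * (B + + 1 + + 1) * (E + + 2) ≡ U * (B + + 1 + E + + 2) * E →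
                 (U * v - V * u) * ((B + + 1) * (B + + 2) * (E + + 2)) ≡ U * u * (E * (E + + 1))
cross₁-cleared U V u v B E ratio ratio′ = begin
  (U * v - V * u) * ((B + + 1) * (B + + 2) * (E + + 2))
    ≡⟨ expand U V u v B E ⟩
  U * (B + + 2) * (v * (B + + 1) * (E + + 2)) - u * (B + + 1) * (V * (B + + 1 + + 1) * (E + + 2))
    ≡⟨ cong₂ (λ s t → U * (B + + 2) * s - u * (B + + 1) * t) ratio ratio′ ⟩
  U * (B + + 2) * (u * (B + E + + 2) * E) - u * (B + + 1) * (U * (B + + 1 + E + + 2) * E)
    ≡⟨ collect U u B E ⟩
  U * u * (E * (E + + 1)) ∎
  where
  open ≡-Reasoning
  expand : ∀ U V u v B E →
    (U * v - V * u) * ((B + + 1) * (B + + 2) * (E + + 2))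
    ≡ U * (B + + 2) * (v * (B + + 1) * (E + + 2)) - u * (B + + 1) * (V * (B + + 1 + + 1) * (E + + 2))
  expand = solve-∀
  collect : ∀ U u B E →
    U * (B + + 2) * (u * (B + E + + 2) * E) - u * (B + + 1) * (U * (B + + 1 + E + + 2) * E)
    ≡ U * u * (E * (E + + 1))
  collect = solve-∀

ballot-cross₁ : ∀ β e {m m′} → suc (2 ℕ.* β ℕ.+ e) ≡ m → suc (2 ℕ.* suc β ℕ.+ e) ≡ m′ →
                ballot m′ (suc (suc β)) * ballot m β ℤ.≤ ballot m′ (suc β) * ballot m (suc β)
ballot-cross₁ β e refl refl =
  ≤-by-multiple 0<P (subst (0ℤ ℤ.≤_) (sym (cross₁-cleared U V u v B E ratio ratio′))
                           (*-nonNeg {U * u} (*-nonNeg 0≤U 0≤u) (*-nonNeg {E} 0≤+ 0≤+)))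
  where
  y = ballot (suc (2 ℕ.* β ℕ.+ e))
  y′ = ballot (suc (2 ℕ.* suc β ℕ.+ e))
  B = + β
  E = + e
  u = y β
  v = y (suc β)
  U = y′ (suc β)
  V = y′ (suc (suc β))
  ratio : v * (B + + 1) * (E + + 2) ≡ u * (B + E + + 2) * E
  ratio = ballot-ratio β e refl refl
  ratio′ : V * (B + + 1 + + 1) * (E + + 2) ≡ U * (B + + 1 + E + + 2) * E
  ratio′ = ballot-ratio (suc β) e (sym (+[k+1] β)) refl
  0<P : 0ℤ ℤ.< (B + + 1) * (B + + 2) * (E + + 2)
  0<P = *-pos {(B + + 1) * (B + + 2)} (*-pos {B + + 1} (+-pos {B} 0≤+ 0<+suc) (+-pos {B} 0≤+ 0<+suc))
                                      (+-pos {E} 0≤+ 0<+suc)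
  0≤U : 0ℤ ℤ.≤ U
  0≤U = ballot-nonNeg _ (suc β) (ℕ.m≤n⇒m≤1+n (ℕ.m≤m+n _ e))
  0≤u : 0ℤ ℤ.≤ u
  0≤u = ballot-nonNeg _ β (ℕ.m≤n⇒m≤1+n (ℕ.m≤m+n _ e))

-- Writing the offset as E + 2 makes the last factor a polynomial with nonnegative coefficients in B and E;
-- for offsets 0 and 1 the coefficient of B would be negative.
cross₂-cleared : ∀ U V u u′ B E → let E₂ = E + + 2; Q = B + E₂ + + 3 in
  V * (B + + 1 + + 1) * (E₂ + + 2) ≡ U * (B + + 1 + E₂ + + 2) * E₂ →
  u * B * (E₂ + + 4) ≡ u′ * Q * (E₂ + + 2) →
  (V * (u + u′) - U * u) * ((B + + 2) * (E₂ + + 2) * (Q * (E₂ + + 2)))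
  ≡ U * u * (Q * (B * (E * E + + 6 * E + + 4) + (E + + 4) * (E * E + + 5 * E + + 2)))
cross₂-cleared U V u u′ B E ratio ratio⁻ = begin
  (V * (u + u′) - U * u) * P
    ≡⟨ expand U V u u′ B E ⟩
  V * (B + + 1 + + 1) * (E₂ + + 2) * (u * Q * (E₂ + + 2) + u′ * Q * (E₂ + + 2)) - U * u * P
    ≡⟨ cong₂ (λ s t → s * (u * Q * (E₂ + + 2) + t) - U * u * P) ratio (sym ratio⁻) ⟩
  U * (B + + 1 + E₂ + + 2) * E₂ * (u * Q * (E₂ + + 2) + u * B * (E₂ + + 4)) - U * u * P
    ≡⟨ collect U u B E ⟩
  U * u * (Q * (B * (E * E + + 6 * E + + 4) + (E + + 4) * (E * E + + 5 * E + + 2))) ∎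
  where
  open ≡-Reasoning
  E₂ = E + + 2
  Q = B + E₂ + + 3
  P = (B + + 2) * (E₂ + + 2) * (Q * (E₂ + + 2))
  expand : ∀ U V u u′ B E → let E₂ = E + + 2; Q = B + E₂ + + 3; P = (B + + 2) * (E₂ + + 2) * (Q * (E₂ + + 2)) in
    (V * (u + u′) - U * u) * P
    ≡ V * (B + + 1 + + 1) * (E₂ + + 2) * (u * Q * (E₂ + + 2) + u′ * Q * (E₂ + + 2)) - U * u * P
  expand = solve-∀
  collect : ∀ U u B E → let E₂ = E + + 2; Q = B + E₂ + + 3; P = (B + + 2) * (E₂ + + 2) * (Q * (E₂ + + 2)) in
    U * (B + + 1 + E₂ + + 2) * E₂ * (u * Q * (E₂ + + 2) + u * B * (E₂ + + 4)) - U * u * P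
    ≡ U * u * (Q * (B * (E * E + + 6 * E + + 4) + (E + + 4) * (E * E + + 5 * E + + 2)))
  collect = solve-∀

ballot-cross₂ : ∀ β e {m m′} → suc (2 ℕ.* β ℕ.+ suc (suc e)) ≡ m → suc (2 ℕ.* suc β ℕ.+ suc (suc e)) ≡ m′ →
                ballot m′ (suc β) * ballot m β ℤ.≤ ballot m′ (suc (suc β)) * (ballot m β + ⟨x⟩ (ballot m) β)
ballot-cross₂ β e refl refl =
  ≤-by-multiple 0<P (subst (0ℤ ℤ.≤_) (sym (cross₂-cleared U V u u′ B E ratio ratio⁻))
                           (*-nonNeg {U * u} (*-nonNeg 0≤U 0≤u) (*-nonNeg {Q} (ℤ.<⇒≤ 0<Q) 0≤S)))
  where
  y = ballot (suc (2 ℕ.* β ℕ.+ suc (suc e)))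
  y′ = ballot (suc (2 ℕ.* suc β ℕ.+ suc (suc e)))
  B = + β
  E = + e
  u = y β
  u′ = ⟨x⟩ y β
  U = y′ (suc β)
  V = y′ (suc (suc β))
  Q = B + (E + + 2) + + 3
  ratio : V * (B + + 1 + + 1) * (E + + 2 + + 2) ≡ U * (B + + 1 + (E + + 2) + + 2) * (E + + 2)
  ratio = ballot-ratio (suc β) (suc (suc e)) (sym (+[k+1] β)) (sym (+[e+2] e))
  ratio⁻ : u * B * (E + + 2 + + 4) ≡ u′ * Q * (E + + 2 + + 2)
  ratio⁻ = ballot-ratio⁻ β (suc (suc e)) refl (sym (+[e+2] e))
  0<Q : 0ℤ ℤ.< Q
  0<Q = +-pos {B + (E + + 2)} 0≤+ 0<+suc
  0<E+4 : 0ℤ ℤ.< E + + 2 + + 2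
  0<E+4 = +-pos {E + + 2} 0≤+ 0<+suc
  0<P : 0ℤ ℤ.< (B + + 2) * (E + + 2 + + 2) * (Q * (E + + 2 + + 2))
  0<P = *-pos {(B + + 2) * (E + + 2 + + 2)} (*-pos {B + + 2} (+-pos {B} 0≤+ 0<+suc) 0<E+4) (*-pos {Q} 0<Q 0<E+4)
  0≤E²+cE+d : ∀ c d → 0ℤ ℤ.≤ E * E + + c * E + + d
  0≤E²+cE+d c d = +-nonNeg {E * E + + c * E} (+-nonNeg {E * E} (*-nonNeg {E} 0≤+ 0≤+) (*-nonNeg {+ c} {E} 0≤+ 0≤+)) 0≤+
  0≤S : 0ℤ ℤ.≤ B * (E * E + + 6 * E + + 4) + (E + + 4) * (E * E + + 5 * E + + 2)
  0≤S = +-nonNeg {B * (E * E + + 6 * E + + 4)} (*-nonNeg {B} 0≤+ (0≤E²+cE+d 6 4)) (*-nonNeg {E + + 4} 0≤+ (0≤E²+cE+d 5 2))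
  0≤U : 0ℤ ℤ.≤ U
  0≤U = ballot-nonNeg _ (suc β) (ℕ.m≤n⇒m≤1+n (ℕ.m≤m+n _ (suc (suc e))))
  0≤u : 0ℤ ℤ.≤ u
  0≤u = ballot-nonNeg _ β (ℕ.m≤n⇒m≤1+n (ℕ.m≤m+n _ (suc (suc e))))

RatioAntitoneAt : Seq → Seq → ℕ → Set
RatioAntitoneAt a y k = a (suc k) * y k ℤ.≤ a k * y (suc k)

RatioAntitone : Seq → Seq → ℕ → Set
RatioAntitone a y c = ∀ k → k ≤ c → RatioAntitoneAt a y k

RatioAntitone-⟨x⟩ : ∀ {a y c} → RatioAntitone a y c → RatioAntitone (⟨x⟩ a) (⟨x⟩ y) (suc c)
RatioAntitone-⟨x⟩ {a} A zero    _         = ℤ.≤-reflexive (ℤ.*-zeroʳ (a 0))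
RatioAntitone-⟨x⟩     A (suc k) (s≤s k≤c) = A k k≤c

RatioAntitoneAt-cong : ∀ {a a′ y y′} k → a ≗ a′ → y ≗ y′ → RatioAntitoneAt a y k → RatioAntitoneAt a′ y′ k
RatioAntitoneAt-cong k a≗a′ y≗y′ =
  subst₂ ℤ._≤_ (cong₂ _*_ (a≗a′ (suc k)) (y≗y′ k)) (cong₂ _*_ (a≗a′ k) (y≗y′ (suc k)))

⟨1+x⟩-antitoneAt : ∀ a y k → 0ℤ ℤ.< y k → 0ℤ ℤ.≤ y (suc k) → 0ℤ ℤ.≤ ⟨x⟩ y k →
                   RatioAntitoneAt a y k → RatioAntitoneAt (⟨x⟩ a) (⟨x⟩ y) k →
                   RatioAntitoneAt (⟨1+x⟩ a) (⟨1+x⟩ y) k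
⟨1+x⟩-antitoneAt a y k 0<y₀ 0≤y₁ 0≤y₋ at at⁻ =
  ≤-by-multiple 0<y₀ (subst (0ℤ ℤ.≤_) (sym (identity a₋ a₀ a₁ y₋ y₀ y₁))
    (+-nonNeg {y₀ * d₀ + y₀ * d₋ + y₁ * d₋}
      (+-nonNeg {y₀ * d₀ + y₀ * d₋} (+-nonNeg {y₀ * d₀} (*-nonNeg (ℤ.<⇒≤ 0<y₀) 0≤d₀) (*-nonNeg (ℤ.<⇒≤ 0<y₀) 0≤d₋))
                (*-nonNeg 0≤y₁ 0≤d₋))
      (*-nonNeg 0≤y₋ 0≤d₀)))
  where
  a₋ = ⟨x⟩ a k
  a₀ = a k
  a₁ = a (suc k)
  y₋ = ⟨x⟩ y k
  y₀ = y k
  y₁ = y (suc k)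
  d₀ = a₀ * y₁ - a₁ * y₀
  d₋ = a₋ * y₀ - a₀ * y₋
  0≤d₀ : 0ℤ ℤ.≤ d₀
  0≤d₀ = ℤ.i≤j⇒0≤j-i at
  0≤d₋ : 0ℤ ℤ.≤ d₋
  0≤d₋ = ℤ.i≤j⇒0≤j-i at⁻
  identity : ∀ a₋ a₀ a₁ y₋ y₀ y₁ → ((a₀ + a₋) * (y₁ + y₀) - (a₁ + a₀) * (y₀ + y₋)) * y₀
             ≡ y₀ * (a₀ * y₁ - a₁ * y₀) + y₀ * (a₋ * y₀ - a₀ * y₋) + y₁ * (a₋ * y₀ - a₀ * y₋) + y₋ * (a₀ * y₁ - a₁ * y₀)
  identity = solve-∀

⟨1+x+x²⟩-antitoneAt-zero : ∀ a y → 0ℤ ℤ.≤ a 0 → 0ℤ ℤ.≤ y 0 → RatioAntitoneAt a y 0 →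
                           RatioAntitoneAt (⟨1+x+x²⟩ a) (⟨1+x⟩ (⟨1+x⟩ y)) 0
⟨1+x+x²⟩-antitoneAt-zero a y 0≤a₀ 0≤y₀ at =
  ℤ.0≤i-j⇒j≤i (subst (0ℤ ℤ.≤_) (sym (identity (a 0) (a 1) (y 0) (y 1)))
                    (+-nonNeg (ℤ.i≤j⇒0≤j-i at) (*-nonNeg 0≤a₀ 0≤y₀)))
  where
  identity : ∀ a₀ a₁ y₀ y₁ → (a₀ + 0ℤ + 0ℤ) * (y₁ + y₀ + (y₀ + 0ℤ)) - (a₁ + a₀ + 0ℤ) * (y₀ + 0ℤ + 0ℤ)
                             ≡ (a₀ * y₁ - a₁ * y₀) + a₀ * y₀
  identity = solve-∀

⟨1+x+x²⟩-antitoneAt-suc : ∀ a y β → let Y = ⟨1+x⟩ (⟨1+x⟩ y) in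
  0ℤ ℤ.≤ ⟨x⟩ y β → 0ℤ ℤ.< y β → 0ℤ ℤ.< y (suc β) → 0ℤ ℤ.≤ y (suc (suc β)) → 0ℤ ℤ.≤ a (suc β) →
  RatioAntitoneAt (⟨x⟩ a) (⟨x⟩ y) β → RatioAntitoneAt a y β → RatioAntitoneAt a y (suc β) →
  Y (suc (suc β)) * y β ℤ.≤ Y (suc β) * y (suc β) →
  Y (suc β) * y β ℤ.≤ Y (suc (suc β)) * (y β + ⟨x⟩ y β) →
  RatioAntitoneAt (⟨1+x+x²⟩ a) Y (suc β)
⟨1+x+x²⟩-antitoneAt-suc a y β 0≤y₀ 0<y₁ 0<y₂ 0≤y₃ 0≤x₂ at₀ at₁ at₂ Y-cross₁ Y-cross₂ =
  ≤-by-multiple (*-pos 0<y₁ 0<y₂) (subst (0ℤ ℤ.≤_) (sym (identity x₀ x₁ x₂ x₃ y₀ y₁ y₂ y₃))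
    (+-nonNeg {t₀ + t₂ + t₁}
      (+-nonNeg {t₀ + t₂}
        (+-nonNeg {t₀} (*-nonNeg (*-nonNeg 0≤Y₃ (ℤ.<⇒≤ 0<y₂)) (ℤ.i≤j⇒0≤j-i at₀))
                       (*-nonNeg (*-nonNeg 0≤Y₂ (ℤ.<⇒≤ 0<y₁)) (ℤ.i≤j⇒0≤j-i at₂)))
        (*-nonNeg (ℤ.i≤j⇒0≤j-i Y-cross₂) (ℤ.i≤j⇒0≤j-i at₁)))
      (*-nonNeg (*-nonNeg (ℤ.i≤j⇒0≤j-i Y-cross₁) (ℤ.<⇒≤ 0<y₁)) 0≤x₂)))
  where
  x₀ = ⟨x⟩ a β
  x₁ = a β
  x₂ = a (suc β)
  x₃ = a (suc (suc β))
  y₀ = ⟨x⟩ y β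
  y₁ = y β
  y₂ = y (suc β)
  y₃ = y (suc (suc β))
  Y₂ = y₂ + y₁ + (y₁ + y₀)
  Y₃ = y₃ + y₂ + (y₂ + y₁)
  t₀ = Y₃ * y₂ * (x₀ * y₁ - x₁ * y₀)
  t₁ = (Y₃ * (y₁ + y₀) - Y₂ * y₁) * (x₁ * y₂ - x₂ * y₁)
  t₂ = Y₂ * y₁ * (x₂ * y₃ - x₃ * y₂)
  0≤Y₂ : 0ℤ ℤ.≤ Y₂
  0≤Y₂ = +-nonNeg {y₂ + y₁} (+-nonNeg (ℤ.<⇒≤ 0<y₂) (ℤ.<⇒≤ 0<y₁)) (+-nonNeg (ℤ.<⇒≤ 0<y₁) 0≤y₀)
  0≤Y₃ : 0ℤ ℤ.≤ Y₃
  0≤Y₃ = +-nonNeg {y₃ + y₂} (+-nonNeg 0≤y₃ (ℤ.<⇒≤ 0<y₂)) (+-nonNeg (ℤ.<⇒≤ 0<y₂) (ℤ.<⇒≤ 0<y₁))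
  identity : ∀ x₀ x₁ x₂ x₃ y₀ y₁ y₂ y₃ → let Y₂ = y₂ + y₁ + (y₁ + y₀); Y₃ = y₃ + y₂ + (y₂ + y₁) in
    ((x₂ + x₁ + x₀) * Y₃ - (x₃ + x₂ + x₁) * Y₂) * (y₁ * y₂)
    ≡ Y₃ * y₂ * (x₀ * y₁ - x₁ * y₀) + Y₂ * y₁ * (x₂ * y₃ - x₃ * y₂)
      + (Y₃ * (y₁ + y₀) - Y₂ * y₁) * (x₁ * y₂ - x₂ * y₁) + (Y₂ * y₂ - Y₃ * y₁) * y₁ * x₂
  identity = solve-∀

record OddLevelInvariant (c : ℕ) (a : Seq) : Set where
  field
    antitone        : RatioAntitone a (ballot (suc (2 ℕ.* c))) c
    nonNeg          : NonNegUpTo c a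
    antipalindromic : Antipalindromic (suc (suc (2 ℕ.* c))) a

open OddLevelInvariant

invariant-ballot : ∀ c → OddLevelInvariant c (ballot (suc (2 ℕ.* c)))
invariant-ballot c = record
  { antitone        = λ k _ → ℤ.≤-reflexive (ℤ.*-comm (y (suc k)) (y k))
  ; nonNeg          = λ k k≤c → ballot-nonNegUpTo c k (ℕ.m≤n⇒m≤1+n k≤c)
  ; antipalindromic = ballot-antipalindromic (suc (2 ℕ.* c))
  }
  where y = ballot (suc (2 ℕ.* c))

invariant-antitone-suc : ∀ {c a} β d → suc β ℕ.+ d ≡ c → OddLevelInvariant c a →
                         RatioAntitoneAt (⟨1+x+x²⟩ a) (ballot (suc (2 ℕ.* suc c))) (suc β)
invariant-antitone-suc {a = a} β d refl I =
  RatioAntitoneAt-cong {⟨1+x+x²⟩ a} (suc β) (λ _ → refl) (λ k → sym (ballot-⟨1+x⟩² c k))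
    (⟨1+x+x²⟩-antitoneAt-suc a y β (NonNegUpTo-⟨x⟩ (ballot-nonNegUpTo c) β β≤c+1)
      (ballot-pos _ β 2β≤2c+1) (ballot-pos _ (suc β) (ℕ.m≤n⇒m≤1+n (ℕ.*-monoʳ-≤ 2 β+1≤c)))
      (ballot-nonNegUpTo c (suc (suc β)) (s≤s β+1≤c)) (nonNeg I (suc β) β+1≤c)
      (RatioAntitone-⟨x⟩ (antitone I) β β≤c+1) (antitone I β β≤c) (antitone I (suc β) β+1≤c)
      cross₁ cross₂)
  where
  c = suc β ℕ.+ d
  e = suc (suc (2 ℕ.* d))
  y = ballot (suc (2 ℕ.* c))
  y′ = ballot (suc (2 ℕ.* suc c))
  Y = ⟨1+x⟩ (⟨1+x⟩ y)
  β+1≤c : suc β ≤ c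
  β+1≤c = ℕ.m≤m+n (suc β) d
  β≤c : β ≤ c
  β≤c = ℕ.m≤n⇒m≤1+n (ℕ.m≤m+n β d)
  β≤c+1 : β ≤ suc c
  β≤c+1 = ℕ.m≤n⇒m≤1+n β≤c
  2β≤2c+1 : 2 ℕ.* β ≤ suc (2 ℕ.* c)
  2β≤2c+1 = ℕ.m≤n⇒m≤1+n (ℕ.*-monoʳ-≤ 2 β≤c)
  level : ∀ β d → suc (2 ℕ.* β ℕ.+ suc (suc (2 ℕ.* d))) ≡ suc (2 ℕ.* (suc β ℕ.+ d))
  level = ℕ-Solver.solve-∀
  level′ : ∀ β d → suc (2 ℕ.* suc β ℕ.+ suc (suc (2 ℕ.* d))) ≡ suc (2 ℕ.* suc (suc β ℕ.+ d))
  level′ = ℕ-Solver.solve-∀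
  cross₁ : Y (suc (suc β)) * y β ℤ.≤ Y (suc β) * y (suc β)
  cross₁ = subst₂ (λ s t → s * y β ℤ.≤ t * y (suc β)) (ballot-⟨1+x⟩² c (suc (suc β))) (ballot-⟨1+x⟩² c (suc β))
                  (ballot-cross₁ β e (level β d) (level′ β d))
  cross₂ : Y (suc β) * y β ℤ.≤ Y (suc (suc β)) * (y β + ⟨x⟩ y β)
  cross₂ = subst₂ (λ s t → s * y β ℤ.≤ t * (y β + ⟨x⟩ y β)) (ballot-⟨1+x⟩² c (suc β)) (ballot-⟨1+x⟩² c (suc (suc β)))
                  (ballot-cross₂ β (2 ℕ.* d) (level β d) (level′ β d))

invariant-⟨1+x+x²⟩ : ∀ {c a} → OddLevelInvariant c a → OddLevelInvariant (suc c) (⟨1+x+x²⟩ a)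
invariant-⟨1+x+x²⟩ {c} {a} I = record { antitone = antitone′ ; nonNeg = nonNeg′ ; antipalindromic = antipalindromic′ }
  where
  y = ballot (suc (2 ℕ.* c))
  y′ = ballot (suc (2 ℕ.* suc c))
  a′ = ⟨1+x+x²⟩ a
  0≤a : NonNegUpTo (suc c) a
  0≤a = NonNegUpTo-suc (nonNeg I) (antipalindromic-middle {c} (antipalindromic I))
  antipalindromic′ : Antipalindromic (suc (suc (2 ℕ.* suc c))) a′
  antipalindromic′ = subst (λ m → Antipalindromic (suc (suc m)) a′) (sym (ℕ.*-suc 2 c))
                           (antipalindromic-⟨1+x+x²⟩ (antipalindromic I))
  nonNeg′ : NonNegUpTo (suc c) a′
  nonNeg′ k k≤c+1 = +-nonNeg (+-nonNeg (0≤a k k≤c+1) (NonNegUpTo-⟨x⟩ 0≤a k k≤c+1))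
                             (NonNegUpTo-⟨x⟩ (NonNegUpTo-⟨x⟩ 0≤a) k k≤c+1)
  antitone′ : RatioAntitone a′ y′ (suc c)
  antitone′ zero    _ = RatioAntitoneAt-cong {a′} 0 (λ _ → refl) (λ k → sym (ballot-⟨1+x⟩² c k))
    (⟨1+x+x²⟩-antitoneAt-zero a y (0≤a 0 z≤n) (ballot-nonNegUpTo c 0 z≤n) (antitone I 0 z≤n))
  antitone′ (suc β) (s≤s β≤c) with ℕ.m≤n⇒m<n∨m≡n β≤c
  ... | inj₂ refl = subst₂ (λ s t → s * y′ (suc c) ℤ.≤ a′ (suc c) * t)
                           (sym (antipalindromic-middle {suc c} antipalindromic′)) (sym (ballot-middle (suc c)))
                           (ℤ.≤-reflexive (sym (ℤ.*-zeroʳ (a′ (suc c)))))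
  ... | inj₁ β<c with ℕ.m≤n⇒∃[o]m+o≡n β<c
  ...   | d , β+1+d≡c = invariant-antitone-suc β d β+1+d≡c I

αℤ-invariant : ∀ i d → OddLevelInvariant (i ℕ.+ d) (αℤ (suc (2 ℕ.* d)) i)
αℤ-invariant zero    d = invariant-ballot d
αℤ-invariant (suc i) d = invariant-⟨1+x+x²⟩ (αℤ-invariant i d)

αℤ-suc : ∀ m i → αℤ (suc m) i ≗ ⟨1+x⟩ (αℤ m i)
αℤ-suc m zero    = ballot-suc m
αℤ-suc m (suc i) k = trans (⟨1+x+x²⟩-cong (αℤ-suc m i) k) (⟨1+x+x²⟩-⟨1+x⟩ (αℤ m i) k)

αℤ-antitone-odd : ∀ h i k → i ≤ h → k ≤ h →
                  RatioAntitoneAt (αℤ (suc (2 ℕ.* h) ∸ 2 ℕ.* i) i) (ballot (suc (2 ℕ.* h))) k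
αℤ-antitone-odd h i k i≤h k≤h with ℕ.m≤n⇒∃[o]m+o≡n i≤h
... | d , refl = subst (λ m → RatioAntitoneAt (αℤ m i) (ballot (suc (2 ℕ.* (i ℕ.+ d)))) k) (sym level)
                       (antitone (αℤ-invariant i d) k k≤h)
  where
  level : suc (2 ℕ.* (i ℕ.+ d)) ∸ 2 ℕ.* i ≡ suc (2 ℕ.* d)
  level = trans (cong (_∸ 2 ℕ.* i) (split i d)) (ℕ.m+n∸n≡m (suc (2 ℕ.* d)) (2 ℕ.* i))
    where
    split : ∀ i d → suc (2 ℕ.* (i ℕ.+ d)) ≡ suc (2 ℕ.* d) ℕ.+ 2 ℕ.* i
    split = ℕ-Solver.solve-∀

αℤ-antitone-even : ∀ h i k → i < h → k < h →
                   RatioAntitoneAt (αℤ (2 ℕ.* h ∸ 2 ℕ.* i) i) (ballot (2 ℕ.* h)) k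
αℤ-antitone-even (suc h) i k (s≤s i≤h) (s≤s k≤h) with ℕ.m≤n⇒∃[o]m+o≡n i≤h
... | d , refl = subst₂ (λ m n → RatioAntitoneAt (αℤ m i) (ballot n) k) (sym level) (sym (ℕ.*-suc 2 (i ℕ.+ d)))
    (RatioAntitoneAt-cong k (λ t → sym (αℤ-suc (suc (2 ℕ.* d)) i t)) (λ t → sym (ballot-suc (suc (2 ℕ.* h)) t))
      (⟨1+x⟩-antitoneAt (αℤ (suc (2 ℕ.* d)) i) y k
        (ballot-pos _ k (ℕ.m≤n⇒m≤1+n (ℕ.*-monoʳ-≤ 2 k≤h))) (ballot-nonNegUpTo h (suc k) (s≤s k≤h))
        (NonNegUpTo-⟨x⟩ (ballot-nonNegUpTo h) k (ℕ.m≤n⇒m≤1+n k≤h))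
        (antitone I k k≤h) (RatioAntitone-⟨x⟩ (antitone I) k (ℕ.m≤n⇒m≤1+n k≤h))))
  where
  y = ballot (suc (2 ℕ.* h))
  I = αℤ-invariant i d
  level : 2 ℕ.* suc (i ℕ.+ d) ∸ 2 ℕ.* i ≡ suc (suc (2 ℕ.* d))
  level = trans (cong (_∸ 2 ℕ.* i) (split i d)) (ℕ.m+n∸n≡m (suc (suc (2 ℕ.* d))) (2 ℕ.* i))
    where
    split : ∀ i d → 2 ℕ.* suc (i ℕ.+ d) ≡ suc (suc (2 ℕ.* d)) ℕ.+ 2 ℕ.* i
    split = ℕ-Solver.solve-∀

parity : ∀ n → n ≡ 2 ℕ.* ⌊ n /2⌋ ⊎ n ≡ suc (2 ℕ.* ⌊ n /2⌋)
parity zero          = inj₁ refl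
parity (suc zero)    = inj₂ refl
parity (suc (suc n)) with parity n
... | inj₁ eq = inj₁ (trans (cong (λ m → suc (suc m)) eq) (sym (ℕ.*-suc 2 ⌊ n /2⌋)))
... | inj₂ eq = inj₂ (cong suc (trans (cong suc eq) (sym (ℕ.*-suc 2 ⌊ n /2⌋))))

αℤ-antitone : ∀ n i k → i < ⌊ n /2⌋ → k < ⌊ n /2⌋ → RatioAntitoneAt (αℤ (n ∸ 2 ℕ.* i) i) (ballot n) k
αℤ-antitone n i k i<h k<h with parity n
... | inj₁ n≡2h   = subst (λ n → RatioAntitoneAt (αℤ (n ∸ 2 ℕ.* i) i) (ballot n) k) (sym n≡2h)
                          (αℤ-antitone-even ⌊ n /2⌋ i k i<h k<h)
... | inj₂ n≡2h+1 = subst (λ n → RatioAntitoneAt (αℤ (n ∸ 2 ℕ.* i) i) (ballot n) k) (sym n≡2h+1)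
                          (αℤ-antitone-odd ⌊ n /2⌋ i k (ℕ.<⇒≤ i<h) (ℕ.<⇒≤ k<h))

fromℤ : ℤ → ℚ
fromℤ z = z ℚ./ 1

coprime-1 : ∀ n → Coprime n 1
coprime-1 n = coprime-sym (1-coprimeTo n)

fromℤ≡mkℚ : ∀ z → fromℤ z ≡ mkℚ z 0 (coprime-1 ℤ.∣ z ∣)
fromℤ≡mkℚ (+ n)    = ℚ.normalize-coprime (coprime-1 n)
fromℤ≡mkℚ -[1+ n ] = cong ℚ.-_ (ℚ.normalize-coprime (coprime-1 (suc n)))

fromℤ-* : ∀ a b → fromℤ a ℚ.* fromℤ b ≡ fromℤ (a * b)
fromℤ-* a b = cong₂ ℚ._*_ (fromℤ≡mkℚ a) (fromℤ≡mkℚ b)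

fromℤ-mono-≤ : ∀ {a b} → a ℤ.≤ b → fromℤ a ℚ.≤ fromℤ b
fromℤ-mono-≤ {a} {b} a≤b = subst₂ ℚ._≤_ (sym (fromℤ≡mkℚ a)) (sym (fromℤ≡mkℚ b))
  (ℚ.*≤* (subst₂ ℤ._≤_ (sym (ℤ.*-identityʳ a)) (sym (ℤ.*-identityʳ b)) a≤b))

fromℤ-positive : ∀ {z} → 0ℤ ℤ.< z → ℚ.Positive (fromℤ z)
fromℤ-positive {z} 0<z = subst ℚ.Positive (sym (fromℤ≡mkℚ z)) (ℤ.positive 0<z)

fromℤ-2^i*halfPow : ∀ i → fromℤ (+ (2 ℕ.^ i)) ℚ.* halfPow i ≡ 1ℚ
fromℤ-2^i*halfPow zero    = refl
fromℤ-2^i*halfPow (suc i) = begin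
  fromℤ (+ (2 ℕ.* 2 ℕ.^ i)) ℚ.* halfPow (suc i)            ≡⟨ cong (λ z → fromℤ z ℚ.* halfPow (suc i)) (ℤ.pos-* 2 (2 ℕ.^ i)) ⟩
  fromℤ (+ 2 * + (2 ℕ.^ i)) ℚ.* halfPow (suc i)            ≡⟨ cong (ℚ._* halfPow (suc i)) (fromℤ-* (+ 2) (+ (2 ℕ.^ i))) ⟨
  (fromℤ (+ 2) ℚ.* p) ℚ.* (½ ℚ.* halfPow i)                ≡⟨ interchange (fromℤ (+ 2)) p ½ (halfPow i) ⟩
  (fromℤ (+ 2) ℚ.* ½) ℚ.* (p ℚ.* halfPow i)                ≡⟨ cong ((fromℤ (+ 2) ℚ.* ½) ℚ.*_) (fromℤ-2^i*halfPow i) ⟩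
  (fromℤ (+ 2) ℚ.* ½) ℚ.* 1ℚ                               ≡⟨ refl ⟩
  1ℚ ∎
  where
  open ≡-Reasoning
  p = fromℤ (+ (2 ℕ.^ i))
  ½ = + 1 ℚ./ 2
  interchange : ∀ a b c d → (a ℚ.* b) ℚ.* (c ℚ.* d) ≡ (a ℚ.* c) ℚ.* (b ℚ.* d)
  interchange = solve 4 (λ a b c d → (a :* b) :* (c :* d) := (a :* c) :* (b :* d)) refl
    where open +-*-Solver

α≡fromℤ-αℤ : ∀ n k i → 2 ℕ.* i ≤ n → α n k i ≡ fromℤ (αℤ (n ∸ 2 ℕ.* i) i k)
α≡fromℤ-αℤ n k i 2i≤n = begin
  fromℤ (binomialSum n i k) ℚ.* halfPow i
    ≡⟨ cong (λ z → fromℤ z ℚ.* halfPow i) sum≡ ⟩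
  fromℤ (+ (2 ℕ.^ i) * A) ℚ.* halfPow i
    ≡⟨ cong (ℚ._* halfPow i) (fromℤ-* (+ (2 ℕ.^ i)) A) ⟨
  (fromℤ (+ (2 ℕ.^ i)) ℚ.* fromℤ A) ℚ.* halfPow i
    ≡⟨ solve 3 (λ p a h → (p :* a) :* h := a :* (p :* h)) refl (fromℤ (+ (2 ℕ.^ i))) (fromℤ A) (halfPow i) ⟩
  fromℤ A ℚ.* (fromℤ (+ (2 ℕ.^ i)) ℚ.* halfPow i)
    ≡⟨ cong (fromℤ A ℚ.*_) (fromℤ-2^i*halfPow i) ⟩
  fromℤ A ℚ.* 1ℚ
    ≡⟨ ℚ.*-identityʳ (fromℤ A) ⟩
  fromℤ A ∎
  where
  open ≡-Reasoning
  open +-*-Solver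
  A = αℤ (n ∸ 2 ℕ.* i) i k
  sum≡ : binomialSum n i k ≡ + (2 ℕ.^ i) * A
  sum≡ = trans (cong (λ m → binomialSum m i k) (sym (ℕ.m+[n∸m]≡n 2i≤n))) (binomialSum≗αℤ i (n ∸ 2 ℕ.* i) k)

x÷?y*y≡x : ∀ x y → y ≢ 0ℚ → (x ÷? y) ℚ.* y ≡ x
x÷?y*y≡x x y y≢0 with y ℚ.≟ 0ℚ
... | yes y≡0 = ⊥-elim (y≢0 y≡0)
... | no  y≢0 = trans (ℚ.*-assoc x (ℚ.1/_ y {{ℚ.≢-nonZero y≢0}}) y)
                      (trans (cong (x ℚ.*_) (ℚ.*-inverseˡ y {{ℚ.≢-nonZero y≢0}})) (ℚ.*-identityʳ x))

fromℤ-≢0 : ∀ {z} → 0ℤ ℤ.< z → fromℤ z ≢ 0ℚ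
fromℤ-≢0 {z} 0<z z≡0 = ℤ.<-irrefl refl (subst (0ℤ ℤ.<_) (cong ℚ.↥_ (trans (sym (fromℤ≡mkℚ z)) z≡0)) 0<z)

cross-≤⇒÷?-≤ : ∀ x₁ x₂ y₁ y₂ → 0ℤ ℤ.< y₁ → 0ℤ ℤ.< y₂ → x₂ * y₁ ℤ.≤ x₁ * y₂ →
           (fromℤ x₂ ÷? fromℤ y₂) ℚ.≤ (fromℤ x₁ ÷? fromℤ y₁)
cross-≤⇒÷?-≤ x₁ x₂ y₁ y₂ 0<y₁ 0<y₂ x₂y₁≤x₁y₂ =
  ℚ.*-cancelʳ-≤-pos (fromℤ (y₁ * y₂)) {{fromℤ-positive (*-pos 0<y₁ 0<y₂)}}
    (subst₂ ℚ._≤_ (sym r₂-scaled) (sym r₁-scaled) (fromℤ-mono-≤ x₂y₁≤x₁y₂))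
  where
  open ≡-Reasoning
  r₁ = fromℤ x₁ ÷? fromℤ y₁
  r₂ = fromℤ x₂ ÷? fromℤ y₂
  r₁-scaled : r₁ ℚ.* fromℤ (y₁ * y₂) ≡ fromℤ (x₁ * y₂)
  r₁-scaled = begin
    r₁ ℚ.* fromℤ (y₁ * y₂)                   ≡⟨ cong (r₁ ℚ.*_) (fromℤ-* y₁ y₂) ⟨
    r₁ ℚ.* (fromℤ y₁ ℚ.* fromℤ y₂)           ≡⟨ ℚ.*-assoc r₁ (fromℤ y₁) (fromℤ y₂) ⟨
    r₁ ℚ.* fromℤ y₁ ℚ.* fromℤ y₂             ≡⟨ cong (ℚ._* fromℤ y₂) (x÷?y*y≡x (fromℤ x₁) (fromℤ y₁) (fromℤ-≢0 0<y₁)) ⟩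
    fromℤ x₁ ℚ.* fromℤ y₂                    ≡⟨ fromℤ-* x₁ y₂ ⟩
    fromℤ (x₁ * y₂)                          ∎
  r₂-scaled : r₂ ℚ.* fromℤ (y₁ * y₂) ≡ fromℤ (x₂ * y₁)
  r₂-scaled = begin
    r₂ ℚ.* fromℤ (y₁ * y₂)                   ≡⟨ cong (λ z → r₂ ℚ.* fromℤ z) (ℤ.*-comm y₁ y₂) ⟩
    r₂ ℚ.* fromℤ (y₂ * y₁)                   ≡⟨ cong (r₂ ℚ.*_) (fromℤ-* y₂ y₁) ⟨
    r₂ ℚ.* (fromℤ y₂ ℚ.* fromℤ y₁)           ≡⟨ ℚ.*-assoc r₂ (fromℤ y₂) (fromℤ y₁) ⟨
    r₂ ℚ.* fromℤ y₂ ℚ.* fromℤ y₁             ≡⟨ cong (ℚ._* fromℤ y₁) (x÷?y*y≡x (fromℤ x₂) (fromℤ y₂) (fromℤ-≢0 0<y₂)) ⟩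
    fromℤ x₂ ℚ.* fromℤ y₁                    ≡⟨ fromℤ-* x₂ y₁ ⟩
    fromℤ (x₂ * y₁)                          ∎

k≤⌊n/2⌋⇒2k≤n : ∀ n {k} → k ≤ ⌊ n /2⌋ → 2 ℕ.* k ≤ n
k≤⌊n/2⌋⇒2k≤n n k≤⌊n/2⌋ = ℕ.≤-trans (ℕ.*-monoʳ-≤ 2 k≤⌊n/2⌋) (twice-half n (parity n))
  where
  twice-half : ∀ n → n ≡ 2 ℕ.* ⌊ n /2⌋ ⊎ n ≡ suc (2 ℕ.* ⌊ n /2⌋) → 2 ℕ.* ⌊ n /2⌋ ≤ n
  twice-half n (inj₁ n≡2h)   = ℕ.≤-reflexive (sym n≡2h)
  twice-half n (inj₂ n≡2h+1) = ℕ.≤-trans (ℕ.n≤1+n _) (ℕ.≤-reflexive (sym n≡2h+1))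

lemma8 : (n k i : ℕ) → 2 ≤ n → k < ⌊ n /2⌋ → i < ⌊ n /2⌋ →
    (α n k i ÷? α n k 0) ≥ (α n (suc k) i ÷? α n (suc k) 0)
lemma8 n k i _ k<⌊n/2⌋ i<⌊n/2⌋ =
  subst₂ ℚ._≤_ (cong₂ _÷?_ (sym (α≡fromℤ-αℤ n (suc k) i 2i≤n)) (sym (α≡fromℤ-αℤ n (suc k) 0 z≤n)))
               (cong₂ _÷?_ (sym (α≡fromℤ-αℤ n k i 2i≤n)) (sym (α≡fromℤ-αℤ n k 0 z≤n)))
    (cross-≤⇒÷?-≤ (αℤ (n ∸ 2 ℕ.* i) i k) (αℤ (n ∸ 2 ℕ.* i) i (suc k)) (ballot n k) (ballot n (suc k))
              (ballot-pos n k (k≤⌊n/2⌋⇒2k≤n n (ℕ.<⇒≤ k<⌊n/2⌋))) (ballot-pos n (suc k) (k≤⌊n/2⌋⇒2k≤n n k<⌊n/2⌋))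
              (αℤ-antitone n i k i<⌊n/2⌋ k<⌊n/2⌋))
  where
  2i≤n : 2 ℕ.* i ≤ n
  2i≤n = k≤⌊n/2⌋⇒2k≤n n (ℕ.<⇒≤ i<⌊n/2⌋)
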